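{- For $n \in \mathbb{Z}^+$ let \[ \mathcal{S}_n^* = \{(a,b,c,d) \in \mathcal{P}_n^4 : \gcd(b,c)=1,\ ab,\ cd,\ ac,\ bd \in \mathcal{P}_n\}. \] Then \[ |\mathcal{S}_n^*| = \frac{(n+1)q^{2n+1}(q+1)}{(q-1)^2} - \frac{(q^{n+1}-1)(3q^{n+1}-1)}{(q-1)^3} = (n+1)q^{2n}(1 + O(1/q)). \]
   Context: $\mathbb{F}$ is a finite field with $q$ elements. $\mathcal{P}_n$ is the set of monic polynomials in $\mathbb{F}[x]$ of degree at most $n$. -}

module Defs where

open import Level using (0ℓ)
open import Data.Nat using (ℕ; zero; suc; _≤_)
open import Data.Fin using (Fin)
open import Data.Product using (Σ; ∃; _×_; _,_; proj₁)
open import Data.List using (List; []; _∷_; map; _++_; [_])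
open import Data.Vec using (Vec; toList)
open import Relation.Binary.PropositionalEquality using (_≡_; _≢_)
open import Algebra.Structures using (IsCommutativeRing)
open import Function.Bundles using (_↔_)

record FiniteField : Set₁ where
  field
    Carrier : Set
    _+_ _*_ : Carrier → Carrier → Carrier
    -_ : Carrier → Carrier
    0# 1# : Carrier
    isCommutativeRing : IsCommutativeRing _≡_ _+_ _*_ -_ 0# 1#
    0≢1 : 0# ≢ 1#
    inverse : ∀ x → x ≢ 0# → ∃ λ y → x * y ≡ 1#
    q : ℕ
    enum : Carrier ↔ Fin q

module Poly (F : FiniteField) where
  open FiniteField F

  -- polynomials as coefficient lists, lowest degree first (not normalised)
  Pol : Set
  Pol = List Carrier

  coeff : Pol → ℕ → Carrier
  coeff []       _       = 0#
  coeff (a ∷ p)  zero    = a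
  coeff (a ∷ p)  (suc i) = coeff p i

  _≈ₚ_ : Pol → Pol → Set
  p ≈ₚ r = ∀ i → coeff p i ≡ coeff r i

  _+ₚ_ : Pol → Pol → Pol
  []      +ₚ r       = r
  (a ∷ p) +ₚ []      = a ∷ p
  (a ∷ p) +ₚ (b ∷ r) = (a + b) ∷ (p +ₚ r)

  _*ₚ_ : Pol → Pol → Pol
  []      *ₚ r = []
  (a ∷ p) *ₚ r = map (a *_) r +ₚ (0# ∷ (p *ₚ r))

  oneₚ : Pol
  oneₚ = [ 1# ]

  _∣ₚ_ : Pol → Pol → Set
  h ∣ₚ p = ∃ λ g → (h *ₚ g) ≈ₚ p

  Coprime : Pol → Pol → Set
  Coprime b c = ∀ h → h ∣ₚ b → h ∣ₚ c → h ∣ₚ oneₚ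

  -- a monic polynomial of degree d, given by its d lower coefficients
  Monic : Set
  Monic = Σ ℕ (Vec Carrier)

  deg : Monic → ℕ
  deg = proj₁

  toPol : Monic → Pol
  toPol (d , v) = toList v ++ [ 1# ]

  InP : ℕ → Pol → Set
  InP n p = ∃ λ (m : Monic) → deg m ≤ n × toPol m ≈ₚ p

  Quad : Set
  Quad = Monic × Monic × Monic × Monic

  InS : ℕ → Quad → Set
  InS n (a , b , c , d) =
    deg a ≤ n × deg b ≤ n × deg c ≤ n × deg d ≤ n ×
    Coprime (toPol b) (toPol c) ×
    InP n (toPol a *ₚ toPol b) × InP n (toPol c *ₚ toPol d) ×
    InP n (toPol a *ₚ toPol c) × InP n (toPol b *ₚ toPol d)

-- Products of monic polynomials are monic of additive degree, so for monic a, b, c, d of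
-- degree ≤ n the membership (a,b,c,d) ∈ 𝒮ₙ* says exactly: b, c coprime and
-- deg a + t ≤ n, deg d + t ≤ n where t = max(deg b, deg c).  For fixed (b,c) there are
-- therefore M(n∸t)² admissible (a,d), with M(k) = 1 + q + ⋯ + qᵏ, and
--     |𝒮ₙ*| = Σ_{t ≤ n} D(t) · M(n∸t)²,
-- where D(t) is the number of coprime monic pairs (b,c) with max(deg b, deg c) = t.
-- Writing C(i,j) for the number of coprime monic pairs of degrees (i,j), Euclidean
-- division by c (a bijection (Q,r) ↦ Qc + r) gives C(k+j,j) = qᵏ·C(j,j); splitting a
-- remainder according to whether its top coefficient vanishes gives C(t,t) = q²ᵗ − q²ᵗ⁻¹
-- for t ≥ 1.  Hence D(0) = 1 and D(t) = q²ᵗ⁻¹(q+1), and the convolution above is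
-- evaluated in closed form by induction on n.
module Submission where

open import Defs
open import Data.Nat using (ℕ; suc; _+_; _*_; _∸_; _^_; _≤_)
open import Data.Product using (∃; _×_)
open import Data.List using (List; length)
open import Data.List.Relation.Unary.Unique.Propositional using (Unique)
open import Data.List.Membership.Propositional using (_∈_)
open import Function.Bundles using (_⇔_)
open import Relation.Binary.PropositionalEquality using (_≡_)

open import Level using (0ℓ)
open import Data.Nat using (zero; _<_; z≤n; s≤s; _≤?_; _⊔_; NonZero; >-nonZero)
open import Data.Nat.Properties
open import Data.Bool using (Bool; true; false; _∧_)
open import Data.Empty using (⊥-elim)
open import Data.Sum using (_⊎_; inj₁; inj₂)
open import Data.Product using (_,_; proj₁; proj₂)
open import Data.List using ([]; _∷_; _++_; map; filter; cartesianProduct; [_])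
open import Data.List.Properties using (length-map; length-++)
open import Data.List.Membership.Propositional using (_∉_)
open import Data.List.Membership.Propositional.Properties
  using (∈-∃++; ∈-map⁺; ∈-map⁻; ∈-++⁻; ∈-++⁺ˡ; ∈-++⁺ʳ; ∈-cartesianProduct⁺; ∈-cartesianProduct⁻; ∈-filter⁺; ∈-filter⁻)
open import Data.List.Relation.Unary.Any using (here; there)
open import Data.List.Relation.Unary.All using (All; []; _∷_)
open import Data.List.Relation.Unary.AllPairs using ([]; _∷_)
open import Data.List.Relation.Unary.Unique.Propositional.Properties using (map⁺; ++⁺; cartesianProduct⁺; filter⁺)
open import Data.Vec using (Vec; []; _∷_; toList)
open import Relation.Nullary using (Dec; yes; no; does; ¬_)
open import Relation.Nullary.Decidable using (_×-dec_; does-⇔; dec-true; dec-false) renaming (map to Dec-map)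
import Function.Properties.Equivalence as ⇔
open import Relation.Binary using (tri<; tri≈; tri>)
open import Relation.Binary.PropositionalEquality using (_≢_; refl; sym; trans; cong; cong₂; subst; module ≡-Reasoning)
open import Function using (_∘_)
open import Function.Bundles using (mk⇔; Equivalence)
open import Data.Nat.Tactic.RingSolver using (solve-∀)

-- Finite sums and counts over lists.  Sets of polynomials are represented by
-- duplicate-free lists, so cardinalities are sums over such lists.
module ListSums where
  open import Data.List.Relation.Unary.All.Properties using (All¬⇒¬Any) renaming (++⁻ to All-++⁻; ++⁺ to All-++⁺)
  open import Algebra.Properties.CommutativeSemigroup +-commutativeSemigroup using (interchange; x∙yz≈y∙xz)

  private variable
    A B : Set

  sumL : (A → ℕ) → List A → ℕ
  sumL f []       = 0
  sumL f (x ∷ xs) = f x + sumL f xs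

  bit : Bool → ℕ
  bit true  = 1
  bit false = 0

  count : (A → Bool) → List A → ℕ
  count f = sumL (λ x → bit (f x))

  sumL-ext∈ : (f g : A → ℕ) (xs : List A) → (∀ {x} → x ∈ xs → f x ≡ g x) → sumL f xs ≡ sumL g xs
  sumL-ext∈ f g []       e = refl
  sumL-ext∈ f g (x ∷ xs) e = cong₂ _+_ (e (here refl)) (sumL-ext∈ f g xs (e ∘ there))

  sumL-ext : (f g : A → ℕ) (xs : List A) → (∀ x → f x ≡ g x) → sumL f xs ≡ sumL g xs
  sumL-ext f g xs e = sumL-ext∈ f g xs (λ {x} _ → e x)

  sumL-const : (a : ℕ) (xs : List A) → sumL (λ _ → a) xs ≡ length xs * a
  sumL-const a []       = refl
  sumL-const a (x ∷ xs) = cong (a +_) (sumL-const a xs)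

  length-as-count : (xs : List A) → length xs ≡ count (λ _ → true) xs
  length-as-count xs = sym (trans (sumL-const 1 xs) (*-identityʳ (length xs)))

  sumL-+ : (f g : A → ℕ) (xs : List A) → sumL (λ x → f x + g x) xs ≡ sumL f xs + sumL g xs
  sumL-+ f g []       = refl
  sumL-+ f g (x ∷ xs) = trans (cong (f x + g x +_) (sumL-+ f g xs)) (interchange (f x) (g x) (sumL f xs) (sumL g xs))

  sumL-scale : (a : ℕ) (f : A → ℕ) (xs : List A) → sumL (λ x → a * f x) xs ≡ a * sumL f xs
  sumL-scale a f []       = sym (*-zeroʳ a)
  sumL-scale a f (x ∷ xs) = trans (cong (a * f x +_) (sumL-scale a f xs)) (sym (*-distribˡ-+ a (f x) (sumL f xs)))

  sumL-++ : (f : A → ℕ) (xs ys : List A) → sumL f (xs ++ ys) ≡ sumL f xs + sumL f ys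
  sumL-++ f []       ys = refl
  sumL-++ f (x ∷ xs) ys = trans (cong (f x +_) (sumL-++ f xs ys)) (sym (+-assoc (f x) _ _))

  sumL-map : (f : B → ℕ) (g : A → B) (xs : List A) → sumL f (map g xs) ≡ sumL (λ x → f (g x)) xs
  sumL-map f g []       = refl
  sumL-map f g (x ∷ xs) = cong (f (g x) +_) (sumL-map f g xs)

  sumL-cp : (h : A × B → ℕ) (xs : List A) (ys : List B) →
    sumL h (cartesianProduct xs ys) ≡ sumL (λ x → sumL (λ y → h (x , y)) ys) xs
  sumL-cp h []       ys = refl
  sumL-cp h (x ∷ xs) ys = trans (sumL-++ h (map (x ,_) ys) (cartesianProduct xs ys))
                                (cong₂ _+_ (sumL-map h (x ,_) ys) (sumL-cp h xs ys))

  sumL-swap : (h : A → B → ℕ) (xs : List A) (ys : List B) →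
    sumL (λ x → sumL (h x) ys) xs ≡ sumL (λ y → sumL (λ x → h x y) xs) ys
  sumL-swap h []       ys = sym (trans (sumL-const 0 ys) (*-zeroʳ (length ys)))
  sumL-swap h (x ∷ xs) ys = trans (cong (sumL (h x) ys +_) (sumL-swap h xs ys))
                                  (sym (sumL-+ (h x) (λ y → sumL (λ x' → h x' y) xs) ys))

  count-∧ˡ : (b : Bool) (f : A → Bool) (xs : List A) → count (λ x → b ∧ f x) xs ≡ bit b * count f xs
  count-∧ˡ true  f xs = sym (+-identityʳ _)
  count-∧ˡ false f xs = trans (sumL-const 0 xs) (*-zeroʳ (length xs))

  count-cp : (f : A → Bool) (g : B → Bool) (xs : List A) (ys : List B) →
    count (λ p → f (proj₁ p) ∧ g (proj₂ p)) (cartesianProduct xs ys) ≡ count f xs * count g ys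
  count-cp f g xs ys = begin
    count (λ p → f (proj₁ p) ∧ g (proj₂ p)) (cartesianProduct xs ys)
      ≡⟨ sumL-cp _ xs ys ⟩
    sumL (λ x → count (λ y → f x ∧ g y) ys) xs
      ≡⟨ sumL-ext _ _ xs (λ x → trans (count-∧ˡ (f x) g ys) (*-comm (bit (f x)) (count g ys))) ⟩
    sumL (λ x → count g ys * bit (f x)) xs
      ≡⟨ sumL-scale (count g ys) _ xs ⟩
    count g ys * count f xs
      ≡⟨ *-comm (count g ys) (count f xs) ⟩
    count f xs * count g ys ∎
    where open ≡-Reasoning

  length-cp : (xs : List A) (ys : List B) → length (cartesianProduct xs ys) ≡ length xs * length ys
  length-cp xs ys = trans (length-as-count (cartesianProduct xs ys))
    (trans (count-cp (λ _ → true) (λ _ → true) xs ys) (sym (cong₂ _*_ (length-as-count xs) (length-as-count ys))))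

  length-filter : {P : A → Set} (P? : ∀ x → Dec (P x)) (xs : List A) →
    length (filter P? xs) ≡ count (λ x → does (P? x)) xs
  length-filter P? []       = refl
  length-filter P? (x ∷ xs) with does (P? x)
  ... | true  = cong suc (length-filter P? xs)
  ... | false = length-filter P? xs

  ∈-remove : ∀ {z x : A} us vs → z ∈ us ++ x ∷ vs → z ≡ x ⊎ z ∈ us ++ vs
  ∈-remove []       vs (here p)  = inj₁ p
  ∈-remove []       vs (there p) = inj₂ p
  ∈-remove (a ∷ us) vs (here p)  = inj₂ (here p)
  ∈-remove (a ∷ us) vs (there p) with ∈-remove us vs p
  ... | inj₁ e = inj₁ e
  ... | inj₂ m = inj₂ (there m)

  ∈-insert : ∀ {z x : A} us vs → z ∈ us ++ vs → z ∈ us ++ x ∷ vs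
  ∈-insert []       vs p         = there p
  ∈-insert (a ∷ us) vs (here p)  = here p
  ∈-insert (a ∷ us) vs (there p) = there (∈-insert us vs p)

  unique-remove : ∀ {x : A} us vs → Unique (us ++ x ∷ vs) → x ∉ us ++ vs × Unique (us ++ vs)
  unique-remove []       vs (x≢vs ∷ u) = All¬⇒¬Any x≢vs , u
  unique-remove {x = x} (a ∷ us) vs (a≢ ∷ u) with unique-remove us vs u | All-++⁻ us a≢
  ... | x∉ , u′ | a≢us , a≢x ∷ a≢vs = x∉′ , (All-++⁺ a≢us a≢vs ∷ u′)
    where
    x∉′ : x ∉ a ∷ us ++ vs
    x∉′ (here e)  = a≢x (sym e)
    x∉′ (there m) = x∉ m

  ⊆-remove : ∀ {x : A} {xs} us vs → All (x ≢_) xs → (∀ {z} → z ∈ x ∷ xs → z ∈ us ++ x ∷ vs) →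
    ∀ {z} → z ∈ xs → z ∈ us ++ vs
  ⊆-remove us vs x∉xs ⊆ m with ∈-remove us vs (⊆ (there m))
  ... | inj₁ refl = ⊥-elim (All¬⇒¬Any x∉xs m)
  ... | inj₂ r    = r

  sumL-remove : (f : A → ℕ) {x : A} (us vs : List A) → sumL f (us ++ x ∷ vs) ≡ f x + sumL f (us ++ vs)
  sumL-remove f {x} us vs = begin
    sumL f (us ++ x ∷ vs)            ≡⟨ sumL-++ f us (x ∷ vs) ⟩
    sumL f us + (f x + sumL f vs)    ≡⟨ x∙yz≈y∙xz (sumL f us) (f x) (sumL f vs) ⟩
    f x + (sumL f us + sumL f vs)    ≡⟨ cong (f x +_) (sym (sumL-++ f us vs)) ⟩
    f x + sumL f (us ++ vs) ∎
    where open ≡-Reasoning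

  sumL-same-members : (f : A → ℕ) (xs ys : List A) → Unique xs → Unique ys →
    (∀ {z} → z ∈ xs → z ∈ ys) → (∀ {z} → z ∈ ys → z ∈ xs) → sumL f xs ≡ sumL f ys
  sumL-same-members f []       []       _ _ _ _ = refl
  sumL-same-members f []       (y ∷ ys) _ _ _ ys⊆ with ys⊆ (here refl)
  ... | ()
  sumL-same-members f (x ∷ xs) ys (x∉xs ∷ uxs) uys xs⊆ ys⊆ with ∈-∃++ (xs⊆ (here refl))
  ... | us , vs , refl with unique-remove us vs uys
  ... | x∉rest , urest =
    trans (cong (f x +_) (sumL-same-members f xs (us ++ vs) uxs urest (⊆-remove us vs x∉xs xs⊆) from))
          (sym (sumL-remove f us vs))
    where
    from : ∀ {z} → z ∈ us ++ vs → z ∈ xs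
    from m with ys⊆ (∈-insert us vs m)
    ... | here refl = ⊥-elim (x∉rest m)
    ... | there r   = r

  pigeonhole : (xs ys : List A) → Unique xs → Unique ys →
    (∀ {z} → z ∈ xs → z ∈ ys) → length xs ≡ length ys → ∀ {z} → z ∈ ys → z ∈ xs
  pigeonhole [] [] _ _ _ _ ()
  pigeonhole (x ∷ xs) ys (x∉xs ∷ uxs) uys xs⊆ len {z} z∈ys with ∈-∃++ (xs⊆ (here refl))
  ... | us , vs , refl with unique-remove us vs uys | ∈-remove us vs z∈ys
  ... | _ , urest | inj₁ refl = here refl
  ... | _ , urest | inj₂ r    = there (pigeonhole xs (us ++ vs) uxs urest (⊆-remove us vs x∉xs xs⊆) len′ r)
    where
    len′ : length xs ≡ length (us ++ vs)
    len′ = suc-injective (trans len (trans (length-++ us) (trans (+-suc (length us) (length vs)) (cong suc (sym (length-++ us))))))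

  Σ≤ : ℕ → (ℕ → ℕ) → ℕ
  Σ≤ zero    f = f 0
  Σ≤ (suc n) f = Σ≤ n f + f (suc n)

  Σ< : ℕ → (ℕ → ℕ) → ℕ
  Σ< zero    f = 0
  Σ< (suc n) f = Σ≤ n f

  Σ≤-ext≤ : ∀ n (f g : ℕ → ℕ) → (∀ t → t ≤ n → f t ≡ g t) → Σ≤ n f ≡ Σ≤ n g
  Σ≤-ext≤ zero    f g e = e 0 z≤n
  Σ≤-ext≤ (suc n) f g e = cong₂ _+_ (Σ≤-ext≤ n f g (λ t le → e t (m≤n⇒m≤1+n le))) (e (suc n) ≤-refl)

  Σ≤-ext : ∀ n (f g : ℕ → ℕ) → (∀ t → f t ≡ g t) → Σ≤ n f ≡ Σ≤ n g
  Σ≤-ext n f g e = Σ≤-ext≤ n f g (λ t _ → e t)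

  Σ≤-+ : ∀ n (f g : ℕ → ℕ) → Σ≤ n (λ t → f t + g t) ≡ Σ≤ n f + Σ≤ n g
  Σ≤-+ zero    f g = refl
  Σ≤-+ (suc n) f g = trans (cong (_+ (f (suc n) + g (suc n))) (Σ≤-+ n f g))
                           (interchange (Σ≤ n f) (Σ≤ n g) (f (suc n)) (g (suc n)))

  Σ≤-scale : ∀ n a (f : ℕ → ℕ) → Σ≤ n (λ t → a * f t) ≡ a * Σ≤ n f
  Σ≤-scale zero    a f = refl
  Σ≤-scale (suc n) a f = trans (cong (_+ a * f (suc n)) (Σ≤-scale n a f)) (sym (*-distribˡ-+ a (Σ≤ n f) (f (suc n))))

  sumL-Σ≤ : ∀ n (h : A → ℕ → ℕ) (xs : List A) → sumL (λ x → Σ≤ n (h x)) xs ≡ Σ≤ n (λ j → sumL (λ x → h x j) xs)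
  sumL-Σ≤ zero    h xs = refl
  sumL-Σ≤ (suc n) h xs = trans (sumL-+ (λ x → Σ≤ n (h x)) (λ x → h x (suc n)) xs)
                               (cong (_+ sumL (λ x → h x (suc n)) xs) (sumL-Σ≤ n h xs))

  -- A square of indices {0..n}² is the disjoint union of the "hooks"
  -- {(t,j) : j ≤ t} ∪ {(i,t) : i < t}, t ≤ n.
  Σ≤-square : ∀ n (H : ℕ → ℕ → ℕ) →
    Σ≤ n (λ i → Σ≤ n (H i)) ≡ Σ≤ n (λ t → Σ≤ t (H t) + Σ< t (λ i → H i t))
  Σ≤-square zero    H = sym (+-identityʳ _)
  Σ≤-square (suc n) H = begin
    Σ≤ (suc n) (λ i → Σ≤ n (H i) + H i (suc n))
      ≡⟨ Σ≤-+ (suc n) (λ i → Σ≤ n (H i)) (λ i → H i (suc n)) ⟩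
    (Σ≤ n (λ i → Σ≤ n (H i)) + Σ≤ n (H (suc n))) + (Σ≤ n (λ i → H i (suc n)) + H (suc n) (suc n))
      ≡⟨ cong (λ z → (z + row) + (col + diag)) (Σ≤-square n H) ⟩
    (hooks + row) + (col + diag)
      ≡⟨ +-assoc hooks row (col + diag) ⟩
    hooks + (row + (col + diag))
      ≡⟨ cong (hooks +_) (trans (cong (row +_) (+-comm col diag)) (sym (+-assoc row diag col))) ⟩
    hooks + ((row + diag) + col) ∎
    where
    open ≡-Reasoning
    hooks = Σ≤ n (λ t → Σ≤ t (H t) + Σ< t (λ i → H i t))
    row   = Σ≤ n (H (suc n))
    col   = Σ≤ n (λ i → H i (suc n))
    diag  = H (suc n) (suc n)

  sumL-cp-swap : (h : A × B → ℕ) (xs : List A) (ys : List B) →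
    sumL h (cartesianProduct xs ys) ≡ sumL (λ p → h (proj₂ p , proj₁ p)) (cartesianProduct ys xs)
  sumL-cp-swap h xs ys = trans (sumL-cp h xs ys)
    (trans (sumL-swap (λ x y → h (x , y)) xs ys) (sym (sumL-cp (λ p → h (proj₂ p , proj₁ p)) ys xs)))

  sumL-bijection : (h : A → ℕ) (f g : A → A) (xs : List A) → Unique xs → (∀ x → x ∈ xs) →
    (∀ x → g (f x) ≡ x) → (∀ x → f (g x) ≡ x) → sumL (h ∘ f) xs ≡ sumL h xs
  sumL-bijection h f g xs uxs complete gf fg = trans (sym (sumL-map h f xs))
    (sumL-same-members h (map f xs) xs (map⁺ f-inj uxs) uxs (λ {z} _ → complete z)
      (λ {z} _ → subst (_∈ map f xs) (fg z) (∈-map⁺ f (complete (g z)))))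
    where
    f-inj : ∀ {x y} → f x ≡ f y → x ≡ y
    f-inj {x} {y} e = trans (sym (gf x)) (trans (cong g e) (gf y))

  sumL-split-at : {z : A} (g : A → ℕ) (X Y : ℕ) (xs : List A) → Unique xs → z ∈ xs →
    g z ≡ X → (∀ a → a ≢ z → g a ≡ Y) → sumL g xs + Y ≡ X + length xs * Y
  sumL-split-at {z = z} g X Y (x ∷ xs) (x∉xs ∷ uxs) (here refl) gz ga = begin
    (g z + sumL g xs) + Y            ≡⟨ cong (λ u → (u + sumL g xs) + Y) gz ⟩
    (X + sumL g xs) + Y              ≡⟨ cong (λ u → (X + u) + Y) rest ⟩
    (X + length xs * Y) + Y          ≡⟨ +-assoc X _ Y ⟩
    X + (length xs * Y + Y)          ≡⟨ cong (X +_) (+-comm (length xs * Y) Y) ⟩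
    X + length (x ∷ xs) * Y ∎
    where
    open ≡-Reasoning
    rest : sumL g xs ≡ length xs * Y
    rest = trans (sumL-ext∈ g (λ _ → Y) xs (λ {a} m → ga a (λ { refl → All¬⇒¬Any x∉xs m })))
                 (sumL-const Y xs)
  sumL-split-at {z = z} g X Y (x ∷ xs) (x∉xs ∷ uxs) (there z∈xs) gz ga = begin
    (g x + sumL g xs) + Y            ≡⟨ cong (λ u → (u + sumL g xs) + Y) (ga x x≢z) ⟩
    (Y + sumL g xs) + Y              ≡⟨ +-assoc Y _ Y ⟩
    Y + (sumL g xs + Y)              ≡⟨ cong (Y +_) (sumL-split-at g X Y xs uxs z∈xs gz ga) ⟩
    Y + (X + length xs * Y)          ≡⟨ x∙yz≈y∙xz Y X _ ⟩
    X + length (x ∷ xs) * Y ∎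
    where
    open ≡-Reasoning
    x≢z : x ≢ z
    x≢z refl = All¬⇒¬Any x∉xs z∈xs

  Σ≤-truncate : ∀ k t (f : ℕ → ℕ) → Σ≤ (k + t) (λ d → bit (does (d ≤? k)) * f d) ≡ Σ≤ k f
  Σ≤-truncate k zero f = trans (cong (λ z → Σ≤ z (λ d → bit (does (d ≤? k)) * f d)) (+-identityʳ k))
    (Σ≤-ext≤ k _ _ (λ d d≤k → trans (cong (λ b → bit b * f d) (dec-true (d ≤? k) d≤k)) (+-identityʳ (f d))))
  Σ≤-truncate k (suc t) f = begin
    Σ≤ (k + suc t) (λ d → bit (does (d ≤? k)) * f d)
      ≡⟨ cong (λ z → Σ≤ z (λ d → bit (does (d ≤? k)) * f d)) (+-suc k t) ⟩
    Σ≤ (k + t) (λ d → bit (does (d ≤? k)) * f d) + bit (does (suc (k + t) ≤? k)) * f (suc (k + t))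
      ≡⟨ cong₂ _+_ (Σ≤-truncate k t f) (cong (λ b → bit b * f (suc (k + t))) (dec-false (suc (k + t) ≤? k) too-big)) ⟩
    Σ≤ k f + 0
      ≡⟨ +-identityʳ _ ⟩
    Σ≤ k f ∎
    where
    open ≡-Reasoning
    too-big : ¬ (suc (k + t) ≤ k)
    too-big le = 1+n≰n (≤-trans le (m≤m+n k t))

module Field (F : FiniteField) where
  open import Algebra.Bundles using (CommutativeRing)
  open import Data.Fin as Fin using (Fin)
  open import Data.Fin.Properties using (¬Fin0) renaming (_≟_ to _≟Fin_)
  open import Data.List using (allFin)
  open import Data.List.Properties using (length-tabulate)
  open import Data.List.Membership.Propositional.Properties using (∈-allFin)
  open import Data.List.Relation.Unary.Unique.Propositional.Properties using (allFin⁺)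
  open import Data.Vec using (_∷ʳ_; initLast) renaming (map to mapV)
  open import Data.Vec.Properties using (∷ʳ-injective; map-∘; map-cong; map-id)
  open import Function.Bundles using (Inverse; _↔_)
  open ListSums

  open FiniteField F public using (Carrier; 0#; 1#; 0≢1; q)
  open FiniteField F using (isCommutativeRing; inverse; enum)

  ring : CommutativeRing 0ℓ 0ℓ
  ring = record { isCommutativeRing = isCommutativeRing }

  module FR = CommutativeRing ring
  open FR public using () renaming (_+_ to _⊕_; _*_ to _⊗_; -_ to ⊝_)

  _≟F_ : (x y : Carrier) → Dec (x ≡ y)
  x ≟F y with Inverse.to enum x ≟Fin Inverse.to enum y
  ... | yes e = yes (trans (sym (Inverse.strictlyInverseʳ enum x))
                    (trans (cong (Inverse.from enum) e) (Inverse.strictlyInverseʳ enum y)))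
  ... | no ne = no (ne ∘ cong (Inverse.to enum))

  inv : (x : Carrier) → x ≢ 0# → Carrier
  inv x nz = proj₁ (inverse x nz)

  inv-l : (x : Carrier) (nz : x ≢ 0#) → inv x nz ⊗ x ≡ 1#
  inv-l x nz = trans (FR.*-comm _ x) (proj₂ (inverse x nz))

  inv-nonzero : (x : Carrier) (nz : x ≢ 0#) → inv x nz ≢ 0#
  inv-nonzero x nz e = 0≢1 (begin
    0#                ≡⟨ sym (FR.zeroˡ x) ⟩
    0# ⊗ x            ≡⟨ cong (_⊗ x) (sym e) ⟩
    inv x nz ⊗ x      ≡⟨ inv-l x nz ⟩
    1# ∎)
    where open ≡-Reasoning

  inv-cancelˡ : ∀ a (na : a ≢ 0#) x → inv a na ⊗ (a ⊗ x) ≡ x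
  inv-cancelˡ a na x = trans (sym (FR.*-assoc _ a x)) (trans (cong (_⊗ x) (inv-l a na)) (FR.*-identityˡ x))

  inv-cancelʳ : ∀ a (na : a ≢ 0#) x → a ⊗ (inv a na ⊗ x) ≡ x
  inv-cancelʳ a na x = trans (sym (FR.*-assoc a _ x)) (trans (cong (_⊗ x) (proj₂ (inverse a na))) (FR.*-identityˡ x))

  -- 0 ≠ 1, so the field has at least two elements
  2≤q : 2 ≤ q
  2≤q = at-least-two q enum
    where
    at-least-two : ∀ n → Carrier ↔ Fin n → 2 ≤ n
    at-least-two zero          e = ⊥-elim (¬Fin0 (Inverse.to e 0#))
    at-least-two (suc zero)    e = ⊥-elim (0≢1 (begin
      0#                              ≡⟨ sym (Inverse.strictlyInverseʳ e 0#) ⟩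
      Inverse.from e (Inverse.to e 0#) ≡⟨ cong (Inverse.from e) (Fin1-unique (Inverse.to e 0#) (Inverse.to e 1#)) ⟩
      Inverse.from e (Inverse.to e 1#) ≡⟨ Inverse.strictlyInverseʳ e 1# ⟩
      1# ∎))
      where
      open ≡-Reasoning
      Fin1-unique : (i j : Fin 1) → i ≡ j
      Fin1-unique Fin.zero Fin.zero = refl
    at-least-two (suc (suc n)) e = s≤s (s≤s z≤n)

  p : ℕ
  p = q ∸ 1

  q≡1+p : q ≡ suc p
  q≡1+p = trans (sym (m∸n+n≡m (≤-trans (s≤s z≤n) 2≤q))) (+-comm p 1)

  p-nonZero : NonZero p
  p-nonZero = >-nonZero (∸-monoˡ-≤ 1 2≤q)

  elements : List Carrier
  elements = map (Inverse.from enum) (allFin q)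

  elements-unique : Unique elements
  elements-unique = map⁺ from-inj (allFin⁺ q)
    where
    from-inj : ∀ {i j} → Inverse.from enum i ≡ Inverse.from enum j → i ≡ j
    from-inj {i} {j} e = trans (sym (Inverse.strictlyInverseˡ enum i))
      (trans (cong (Inverse.to enum) e) (Inverse.strictlyInverseˡ enum j))

  elements-complete : ∀ x → x ∈ elements
  elements-complete x = subst (_∈ elements) (Inverse.strictlyInverseʳ enum x)
    (∈-map⁺ (Inverse.from enum) (∈-allFin (Inverse.to enum x)))

  elements-length : length elements ≡ q
  elements-length = trans (length-map _ (allFin q)) (length-tabulate {n = q} (λ i → i))

  V : ℕ → Set
  V = Vec Carrier

  snoc : ∀ {d} → Carrier × V d → V (suc d)
  snoc (a , v) = v ∷ʳ a

  vectors : (d : ℕ) → List (V d)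
  vectors zero    = [ [] ]
  vectors (suc d) = map snoc (cartesianProduct elements (vectors d))

  vectors-unique : ∀ d → Unique (vectors d)
  vectors-unique zero    = [] ∷ []
  vectors-unique (suc d) = map⁺ snoc-inj (cartesianProduct⁺ elements-unique (vectors-unique d))
    where
    snoc-inj : ∀ {x y : Carrier × V d} → snoc x ≡ snoc y → x ≡ y
    snoc-inj {a , v} {b , w} e with ∷ʳ-injective v w e
    ... | refl , refl = refl

  vectors-complete : ∀ d (v : V d) → v ∈ vectors d
  vectors-complete zero    [] = here refl
  vectors-complete (suc d) w with initLast w
  ... | ys , y , refl = ∈-map⁺ snoc (∈-cartesianProduct⁺ (elements-complete y) (vectors-complete d ys))

  vectors-length : ∀ d → length (vectors d) ≡ q ^ d
  vectors-length zero    = refl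
  vectors-length (suc d) = trans (length-map snoc (cartesianProduct elements (vectors d)))
    (trans (length-cp elements (vectors d)) (cong₂ _*_ elements-length (vectors-length d)))

  scaleV : ∀ {m} → Carrier → V m → V m
  scaleV a = mapV (a ⊗_)

  scaleV-inv : ∀ {m} a (na : a ≢ 0#) (v : V m) → scaleV a (scaleV (inv a na) v) ≡ v
  scaleV-inv a na v = trans (sym (map-∘ (a ⊗_) (inv a na ⊗_) v))
                            (trans (map-cong (inv-cancelʳ a na) v) (map-id v))

  scaleV-inv′ : ∀ {m} a (na : a ≢ 0#) (v : V m) → scaleV (inv a na) (scaleV a v) ≡ v
  scaleV-inv′ a na v = trans (sym (map-∘ (inv a na ⊗_) (a ⊗_) v))
                             (trans (map-cong (inv-cancelˡ a na) v) (map-id v))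

module PolyRing (F : FiniteField) where
  open Field F
  open Poly F
  open import Algebra.Properties.CommutativeSemigroup FR.+-commutativeSemigroup
    using () renaming (interchange to ⊕-interchange; x∙yz≈y∙xz to ⊕-left-comm)
  open import Algebra.Properties.Ring FR.ring using (-1*x≈-x)

  scale : Carrier → Pol → Pol
  scale a r = map (a ⊗_) r

  AllZero : Pol → Set
  AllZero p = ∀ i → coeff p i ≡ 0#

  coeff-+ : ∀ p r i → coeff (p +ₚ r) i ≡ coeff p i ⊕ coeff r i
  coeff-+ []      r       i       = sym (FR.+-identityˡ _)
  coeff-+ (a ∷ p) []      i       = sym (FR.+-identityʳ _)
  coeff-+ (a ∷ p) (b ∷ r) zero    = refl
  coeff-+ (a ∷ p) (b ∷ r) (suc i) = coeff-+ p r i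

  coeff-scale : ∀ a r i → coeff (scale a r) i ≡ a ⊗ coeff r i
  coeff-scale a []      i       = sym (FR.zeroʳ a)
  coeff-scale a (b ∷ r) zero    = refl
  coeff-scale a (b ∷ r) (suc i) = coeff-scale a r i

  coeff-*-zero : ∀ a p r → coeff ((a ∷ p) *ₚ r) 0 ≡ a ⊗ coeff r 0
  coeff-*-zero a p r = trans (coeff-+ (scale a r) (0# ∷ (p *ₚ r)) 0)
    (trans (cong (_⊕ 0#) (coeff-scale a r 0)) (FR.+-identityʳ _))

  coeff-*-suc : ∀ a p r i → coeff ((a ∷ p) *ₚ r) (suc i) ≡ a ⊗ coeff r (suc i) ⊕ coeff (p *ₚ r) i
  coeff-*-suc a p r i = trans (coeff-+ (scale a r) (0# ∷ (p *ₚ r)) (suc i))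
    (cong (_⊕ coeff (p *ₚ r) i) (coeff-scale a r (suc i)))

  *ₚ-zeroˡ : ∀ p r → AllZero p → AllZero (p *ₚ r)
  *ₚ-zeroˡ []      r z i       = refl
  *ₚ-zeroˡ (a ∷ p) r z zero    = trans (coeff-*-zero a p r) (trans (cong (_⊗ _) (z 0)) (FR.zeroˡ _))
  *ₚ-zeroˡ (a ∷ p) r z (suc i) = trans (coeff-*-suc a p r i)
    (trans (cong₂ _⊕_ (trans (cong (_⊗ _) (z 0)) (FR.zeroˡ _)) (*ₚ-zeroˡ p r (z ∘ suc) i)) (FR.+-identityˡ 0#))

  *ₚ-zeroʳ : ∀ p r → AllZero r → AllZero (p *ₚ r)
  *ₚ-zeroʳ []      r z i       = refl
  *ₚ-zeroʳ (a ∷ p) r z zero    = trans (coeff-*-zero a p r) (trans (cong (a ⊗_) (z 0)) (FR.zeroʳ _))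
  *ₚ-zeroʳ (a ∷ p) r z (suc i) = trans (coeff-*-suc a p r i)
    (trans (cong₂ _⊕_ (trans (cong (a ⊗_) (z (suc i))) (FR.zeroʳ _)) (*ₚ-zeroʳ p r z i)) (FR.+-identityˡ 0#))

  +ₚ-cong : ∀ {p p′ r r′} → p ≈ₚ p′ → r ≈ₚ r′ → (p +ₚ r) ≈ₚ (p′ +ₚ r′)
  +ₚ-cong {p} {p′} {r} {r′} e f i = trans (coeff-+ p r i) (trans (cong₂ _⊕_ (e i) (f i)) (sym (coeff-+ p′ r′ i)))

  ∷-cong : ∀ {a p p′} → p ≈ₚ p′ → (a ∷ p) ≈ₚ (a ∷ p′)
  ∷-cong e zero    = refl
  ∷-cong e (suc i) = e i

  *ₚ-congʳ : ∀ p {r r′} → r ≈ₚ r′ → (p *ₚ r) ≈ₚ (p *ₚ r′)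
  *ₚ-congʳ []      e i = refl
  *ₚ-congʳ (a ∷ p) {r} {r′} e zero    = trans (coeff-*-zero a p r)
    (trans (cong (a ⊗_) (e 0)) (sym (coeff-*-zero a p r′)))
  *ₚ-congʳ (a ∷ p) {r} {r′} e (suc i) = trans (coeff-*-suc a p r i)
    (trans (cong₂ _⊕_ (cong (a ⊗_) (e (suc i))) (*ₚ-congʳ p e i)) (sym (coeff-*-suc a p r′ i)))

  *ₚ-congˡ : ∀ {p p′} r → p ≈ₚ p′ → (p *ₚ r) ≈ₚ (p′ *ₚ r)
  *ₚ-congˡ {[]}    {[]}      r e i = refl
  *ₚ-congˡ {[]}    {a′ ∷ p′} r e i = sym (*ₚ-zeroˡ (a′ ∷ p′) r (sym ∘ e) i)
  *ₚ-congˡ {a ∷ p} {[]}      r e i = *ₚ-zeroˡ (a ∷ p) r e i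
  *ₚ-congˡ {a ∷ p} {a′ ∷ p′} r e zero    = trans (coeff-*-zero a p r)
    (trans (cong (_⊗ _) (e 0)) (sym (coeff-*-zero a′ p′ r)))
  *ₚ-congˡ {a ∷ p} {a′ ∷ p′} r e (suc i) = trans (coeff-*-suc a p r i)
    (trans (cong₂ _⊕_ (cong (_⊗ _) (e 0)) (*ₚ-congˡ {p} {p′} r (e ∘ suc) i)) (sym (coeff-*-suc a′ p′ r i)))

  *ₚ-distribʳ : ∀ p p′ r → ((p +ₚ p′) *ₚ r) ≈ₚ ((p *ₚ r) +ₚ (p′ *ₚ r))
  *ₚ-distribʳ []      p′       r i = refl
  *ₚ-distribʳ (a ∷ p) []       r i = sym (trans (coeff-+ ((a ∷ p) *ₚ r) [] i) (FR.+-identityʳ _))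
  *ₚ-distribʳ (a ∷ p) (b ∷ p′) r zero = trans (coeff-*-zero (a ⊕ b) (p +ₚ p′) r)
    (trans (FR.distribʳ _ a b) (sym (trans (coeff-+ ((a ∷ p) *ₚ r) ((b ∷ p′) *ₚ r) 0)
      (cong₂ _⊕_ (coeff-*-zero a p r) (coeff-*-zero b p′ r)))))
  *ₚ-distribʳ (a ∷ p) (b ∷ p′) r (suc i) = begin
    coeff (((a ⊕ b) ∷ (p +ₚ p′)) *ₚ r) (suc i)
      ≡⟨ coeff-*-suc (a ⊕ b) (p +ₚ p′) r i ⟩
    (a ⊕ b) ⊗ coeff r (suc i) ⊕ coeff ((p +ₚ p′) *ₚ r) i
      ≡⟨ cong₂ _⊕_ (FR.distribʳ _ a b) (trans (*ₚ-distribʳ p p′ r i) (coeff-+ (p *ₚ r) (p′ *ₚ r) i)) ⟩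
    (a ⊗ coeff r (suc i) ⊕ b ⊗ coeff r (suc i)) ⊕ (coeff (p *ₚ r) i ⊕ coeff (p′ *ₚ r) i)
      ≡⟨ ⊕-interchange _ _ _ _ ⟩
    (a ⊗ coeff r (suc i) ⊕ coeff (p *ₚ r) i) ⊕ (b ⊗ coeff r (suc i) ⊕ coeff (p′ *ₚ r) i)
      ≡⟨ sym (cong₂ _⊕_ (coeff-*-suc a p r i) (coeff-*-suc b p′ r i)) ⟩
    coeff ((a ∷ p) *ₚ r) (suc i) ⊕ coeff ((b ∷ p′) *ₚ r) (suc i)
      ≡⟨ sym (coeff-+ ((a ∷ p) *ₚ r) ((b ∷ p′) *ₚ r) (suc i)) ⟩
    coeff (((a ∷ p) *ₚ r) +ₚ ((b ∷ p′) *ₚ r)) (suc i) ∎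
    where open ≡-Reasoning

  scale-*ₚ : ∀ a p r → ((scale a p) *ₚ r) ≈ₚ scale a (p *ₚ r)
  scale-*ₚ a []      r i    = refl
  scale-*ₚ a (b ∷ p) r zero = trans (coeff-*-zero (a ⊗ b) (scale a p) r)
    (trans (FR.*-assoc a b _) (sym (trans (coeff-scale a ((b ∷ p) *ₚ r) 0) (cong (a ⊗_) (coeff-*-zero b p r)))))
  scale-*ₚ a (b ∷ p) r (suc i) = begin
    coeff ((scale a (b ∷ p)) *ₚ r) (suc i)
      ≡⟨ coeff-*-suc (a ⊗ b) (scale a p) r i ⟩
    (a ⊗ b) ⊗ coeff r (suc i) ⊕ coeff (scale a p *ₚ r) i
      ≡⟨ cong₂ _⊕_ (FR.*-assoc a b _) (trans (scale-*ₚ a p r i) (coeff-scale a (p *ₚ r) i)) ⟩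
    a ⊗ (b ⊗ coeff r (suc i)) ⊕ a ⊗ coeff (p *ₚ r) i
      ≡⟨ sym (FR.distribˡ a _ _) ⟩
    a ⊗ (b ⊗ coeff r (suc i) ⊕ coeff (p *ₚ r) i)
      ≡⟨ sym (trans (coeff-scale a ((b ∷ p) *ₚ r) (suc i)) (cong (a ⊗_) (coeff-*-suc b p r i))) ⟩
    coeff (scale a ((b ∷ p) *ₚ r)) (suc i) ∎
    where open ≡-Reasoning

  shift-*ₚ : ∀ p r → ((0# ∷ p) *ₚ r) ≈ₚ (0# ∷ (p *ₚ r))
  shift-*ₚ p r zero    = trans (coeff-*-zero 0# p r) (FR.zeroˡ _)
  shift-*ₚ p r (suc i) = trans (coeff-*-suc 0# p r i)
    (trans (cong (_⊕ coeff (p *ₚ r) i) (FR.zeroˡ _)) (FR.+-identityˡ _))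

  *ₚ-assoc : ∀ p r s → ((p *ₚ r) *ₚ s) ≈ₚ (p *ₚ (r *ₚ s))
  *ₚ-assoc []      r s i = refl
  *ₚ-assoc (a ∷ p) r s i = trans (*ₚ-distribʳ (scale a r) (0# ∷ (p *ₚ r)) s i)
    (+ₚ-cong {scale a r *ₚ s} {scale a (r *ₚ s)} {(0# ∷ (p *ₚ r)) *ₚ s} {0# ∷ (p *ₚ (r *ₚ s))}
      (scale-*ₚ a r s) (λ j → trans (shift-*ₚ (p *ₚ r) s j) (∷-cong (*ₚ-assoc p r s) j)) i)

  *ₚ-∷ʳ : ∀ r a p → (r *ₚ (a ∷ p)) ≈ₚ (scale a r +ₚ (0# ∷ (r *ₚ p)))
  *ₚ-∷ʳ []      a p zero    = refl
  *ₚ-∷ʳ []      a p (suc i) = refl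
  *ₚ-∷ʳ (b ∷ r) a p zero    = trans (coeff-*-zero b r (a ∷ p)) (trans (FR.*-comm b a) (sym (FR.+-identityʳ _)))
  *ₚ-∷ʳ (b ∷ r) a p (suc i) = begin
    coeff ((b ∷ r) *ₚ (a ∷ p)) (suc i)
      ≡⟨ coeff-*-suc b r (a ∷ p) i ⟩
    b ⊗ coeff p i ⊕ coeff (r *ₚ (a ∷ p)) i
      ≡⟨ cong (b ⊗ coeff p i ⊕_) (trans (*ₚ-∷ʳ r a p i) (coeff-+ (scale a r) (0# ∷ (r *ₚ p)) i)) ⟩
    b ⊗ coeff p i ⊕ (coeff (scale a r) i ⊕ coeff (0# ∷ (r *ₚ p)) i)
      ≡⟨ ⊕-left-comm _ _ _ ⟩
    coeff (scale a r) i ⊕ (b ⊗ coeff p i ⊕ coeff (0# ∷ (r *ₚ p)) i)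
      ≡⟨ cong (coeff (scale a r) i ⊕_) (sym (trans (coeff-+ (scale b p) (0# ∷ (r *ₚ p)) i)
                                           (cong (_⊕ coeff (0# ∷ (r *ₚ p)) i) (coeff-scale b p i)))) ⟩
    coeff (scale a r) i ⊕ coeff ((b ∷ r) *ₚ p) i
      ≡⟨ sym (coeff-+ (scale a r) ((b ∷ r) *ₚ p) i) ⟩
    coeff (scale a (b ∷ r) +ₚ (0# ∷ ((b ∷ r) *ₚ p))) (suc i) ∎
    where open ≡-Reasoning

  *ₚ-comm : ∀ p r → (p *ₚ r) ≈ₚ (r *ₚ p)
  *ₚ-comm []      r i = sym (*ₚ-zeroʳ r [] (λ _ → refl) i)
  *ₚ-comm (a ∷ p) r i = trans (+ₚ-cong {scale a r} {scale a r} {0# ∷ (p *ₚ r)} {0# ∷ (r *ₚ p)}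
    (λ _ → refl) (∷-cong (*ₚ-comm p r)) i) (sym (*ₚ-∷ʳ r a p i))

  *ₚ-distribˡ : ∀ p r r′ → (p *ₚ (r +ₚ r′)) ≈ₚ ((p *ₚ r) +ₚ (p *ₚ r′))
  *ₚ-distribˡ p r r′ i = trans (*ₚ-comm p (r +ₚ r′) i) (trans (*ₚ-distribʳ r r′ p i)
    (+ₚ-cong {r *ₚ p} {p *ₚ r} {r′ *ₚ p} {p *ₚ r′} (*ₚ-comm r p) (*ₚ-comm r′ p) i))

  *ₚ-identityʳ : ∀ p → (p *ₚ oneₚ) ≈ₚ p
  *ₚ-identityʳ p i = trans (*ₚ-comm p oneₚ i) (identityˡ i)
    where
    identityˡ : (oneₚ *ₚ p) ≈ₚ p
    identityˡ zero    = trans (coeff-*-zero 1# [] p) (FR.*-identityˡ _)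
    identityˡ (suc i) = trans (coeff-*-suc 1# [] p i) (trans (FR.+-identityʳ _) (FR.*-identityˡ _))

  scale-cong : ∀ a {p p′} → p ≈ₚ p′ → scale a p ≈ₚ scale a p′
  scale-cong a {p} {p′} e i = trans (coeff-scale a p i) (trans (cong (a ⊗_) (e i)) (sym (coeff-scale a p′ i)))

  scale-inv : ∀ a (na : a ≢ 0#) p → scale (inv a na) (scale a p) ≈ₚ p
  scale-inv a na p i = trans (coeff-scale (inv a na) (scale a p) i)
    (trans (cong (inv a na ⊗_) (coeff-scale a p i)) (inv-cancelˡ a na (coeff p i)))

  *ₚ-scale : ∀ a p r → (p *ₚ scale a r) ≈ₚ scale a (p *ₚ r)
  *ₚ-scale a p r i = trans (*ₚ-comm p (scale a r) i)
    (trans (scale-*ₚ a r p i) (scale-cong a {r *ₚ p} {p *ₚ r} (*ₚ-comm r p) i))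

  _-ₚ_ : Pol → Pol → Pol
  p -ₚ r = p +ₚ scale (⊝ 1#) r

  coeff-scale-neg : ∀ r i → coeff (scale (⊝ 1#) r) i ≡ ⊝ coeff r i
  coeff-scale-neg r i = trans (coeff-scale (⊝ 1#) r i) (-1*x≈-x _)

  coeff-- : ∀ p r i → coeff (p -ₚ r) i ≡ coeff p i ⊕ ⊝ coeff r i
  coeff-- p r i = trans (coeff-+ p (scale (⊝ 1#) r) i) (cong (coeff p i ⊕_) (coeff-scale-neg r i))

module Degrees (F : FiniteField) where
  open Field F
  open PolyRing F
  open Poly F

  DegBelow : ℕ → Pol → Set
  DegBelow n p = ∀ m → n ≤ m → coeff p m ≡ 0#

  toPol-degBelow : ∀ d (v : V d) → DegBelow (suc d) (toPol (d , v))
  toPol-degBelow zero    []      (suc m) le        = refl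
  toPol-degBelow (suc d) (x ∷ v) (suc m) (s≤s le)  = toPol-degBelow d v m le

  toPol-leading : ∀ d (v : V d) → coeff (toPol (d , v)) d ≡ 1#
  toPol-leading zero    []      = refl
  toPol-leading (suc d) (x ∷ v) = toPol-leading d v

  toList-degBelow : ∀ j (s : V j) → DegBelow j (toList s)
  toList-degBelow zero    []      m       le       = refl
  toList-degBelow (suc j) (x ∷ s) (suc m) (s≤s le) = toList-degBelow j s m le

  degBelow-+ : ∀ n p r → DegBelow n p → DegBelow n r → DegBelow n (p +ₚ r)
  degBelow-+ n p r lp lr m le = trans (coeff-+ p r m) (trans (cong₂ _⊕_ (lp m le) (lr m le)) (FR.+-identityˡ 0#))

  degBelow-scale : ∀ n a p → DegBelow n p → DegBelow n (scale a p)
  degBelow-scale n a p l m le = trans (coeff-scale a p m) (trans (cong (a ⊗_) (l m le)) (FR.zeroʳ a))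

  top-coeff-* : ∀ e f u v → DegBelow (suc e) u → DegBelow (suc f) v →
    (coeff (u *ₚ v) (e + f) ≡ coeff u e ⊗ coeff v f) × DegBelow (suc (e + f)) (u *ₚ v)
  top-coeff-* e f [] v lu lv = sym (FR.zeroˡ _) , (λ m le → refl)
  top-coeff-* zero f (a ∷ u) v lu lv = top , below
    where
    u≡0 : AllZero u
    u≡0 k = lu (suc k) (s≤s z≤n)
    coeff-at : ∀ k → coeff ((a ∷ u) *ₚ v) k ≡ a ⊗ coeff v k
    coeff-at zero     = coeff-*-zero a u v
    coeff-at (suc k)  = trans (coeff-*-suc a u v k)
                          (trans (cong (a ⊗ coeff v (suc k) ⊕_) (*ₚ-zeroˡ u v u≡0 k)) (FR.+-identityʳ _))
    top : coeff ((a ∷ u) *ₚ v) f ≡ a ⊗ coeff v f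
    top = coeff-at f
    below : DegBelow (suc f) ((a ∷ u) *ₚ v)
    below (suc m) (s≤s le) = trans (coeff-*-suc a u v m)
      (trans (cong₂ _⊕_ (trans (cong (a ⊗_) (lv (suc m) (s≤s le))) (FR.zeroʳ a)) (*ₚ-zeroˡ u v u≡0 m))
             (FR.+-identityˡ 0#))
  top-coeff-* (suc e) f (a ∷ u) v lu lv = top , below
    where
    ih = top-coeff-* e f u v (λ m le → lu (suc m) (s≤s le)) lv
    a·v-vanishes : ∀ m → suc f ≤ m → a ⊗ coeff v m ≡ 0#
    a·v-vanishes m le = trans (cong (a ⊗_) (lv m le)) (FR.zeroʳ a)
    top : coeff ((a ∷ u) *ₚ v) (suc (e + f)) ≡ coeff u e ⊗ coeff v f
    top = trans (coeff-*-suc a u v (e + f))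
      (trans (cong₂ _⊕_ (a·v-vanishes (suc (e + f)) (s≤s (m≤n+m f e))) (proj₁ ih)) (FR.+-identityˡ _))
    below : DegBelow (suc (suc (e + f))) ((a ∷ u) *ₚ v)
    below (suc m) (s≤s le) = trans (coeff-*-suc a u v m)
      (trans (cong₂ _⊕_ (a·v-vanishes (suc m) (≤-trans (s≤s (m≤n+m f e)) (m≤n⇒m≤1+n le))) (proj₂ ih m le))
             (FR.+-identityˡ 0#))

  zero-or-top : ∀ p → AllZero p ⊎ (∃ λ e → coeff p e ≢ 0# × DegBelow (suc e) p)
  zero-or-top []      = inj₁ (λ _ → refl)
  zero-or-top (a ∷ p) with zero-or-top p
  ... | inj₂ (e , ne , l) = inj₂ (suc e , ne , λ { (suc m) (s≤s le) → l m le })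
  ... | inj₁ z with a ≟F 0#
  ...   | yes a≡0 = inj₁ (λ { zero → a≡0 ; (suc k) → z k })
  ...   | no  a≢0 = inj₂ (0 , a≢0 , λ { (suc m) _ → z m })

  tail : Pol → Pol
  tail []      = []
  tail (a ∷ p) = p

  coeff-tail : ∀ p k → coeff (tail p) k ≡ coeff p (suc k)
  coeff-tail []      k = refl
  coeff-tail (a ∷ p) k = refl

  lowerCoeffs : (d : ℕ) → Pol → V d
  lowerCoeffs zero    p = []
  lowerCoeffs (suc d) p = coeff p 0 ∷ lowerCoeffs d (tail p)

  monic-from : ∀ d p → DegBelow (suc d) p → coeff p d ≡ 1# → toPol (d , lowerCoeffs d p) ≈ₚ p
  monic-from zero    p l c zero    = sym c
  monic-from zero    p l c (suc i) = sym (l (suc i) (s≤s z≤n))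
  monic-from (suc d) p l c zero    = refl
  monic-from (suc d) p l c (suc i) =
    trans (monic-from d (tail p) l′ (trans (coeff-tail p d) c) i) (coeff-tail p i)
    where
    l′ : DegBelow (suc d) (tail p)
    l′ m le = trans (coeff-tail p m) (l (suc m) (s≤s le))

  lowerCoeffs-toPol : ∀ d (v : V d) → lowerCoeffs d (toPol (d , v)) ≡ v
  lowerCoeffs-toPol zero    []      = refl
  lowerCoeffs-toPol (suc d) (x ∷ v) = cong (x ∷_) (lowerCoeffs-toPol d v)

  lowerCoeffs-cong : ∀ d p r → p ≈ₚ r → lowerCoeffs d p ≡ lowerCoeffs d r
  lowerCoeffs-cong zero    p r e = refl
  lowerCoeffs-cong (suc d) p r e = cong₂ _∷_ (e 0) (lowerCoeffs-cong d (tail p) (tail r)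
    (λ k → trans (coeff-tail p k) (trans (e (suc k)) (sym (coeff-tail r k)))))

  toPol-injective-≡deg : ∀ d (v v′ : V d) → toPol (d , v) ≈ₚ toPol (d , v′) → v ≡ v′
  toPol-injective-≡deg d v v′ e =
    trans (sym (lowerCoeffs-toPol d v)) (trans (lowerCoeffs-cong d _ _ e) (lowerCoeffs-toPol d v′))

  toPol-injective : ∀ (m m′ : Monic) → toPol m ≈ₚ toPol m′ → m ≡ m′
  toPol-injective (d , v) (d′ , v′) e with <-cmp d d′
  ... | tri< lt _ _ = ⊥-elim (0≢1 (trans (sym (toPol-degBelow d v d′ lt)) (trans (e d′) (toPol-leading d′ v′))))
  ... | tri> _ _ gt = ⊥-elim (0≢1 (trans (sym (toPol-degBelow d′ v′ d gt)) (trans (sym (e d)) (toPol-leading d v))))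
  ... | tri≈ _ refl _ = cong (d ,_) (toPol-injective-≡deg d v v′ e)

  toList-injective : ∀ j (s s′ : V j) → toList s ≈ₚ toList s′ → s ≡ s′
  toList-injective zero    []      []        e = refl
  toList-injective (suc j) (x ∷ s) (x′ ∷ s′) e = cong₂ _∷_ (e 0) (toList-injective j s s′ (e ∘ suc))

  monic-* : ∀ (a b : Monic) →
    DegBelow (suc (deg a + deg b)) (toPol a *ₚ toPol b) × coeff (toPol a *ₚ toPol b) (deg a + deg b) ≡ 1#
  monic-* (da , va) (db , vb) with top-coeff-* da db (toPol (da , va)) (toPol (db , vb)) (toPol-degBelow da va) (toPol-degBelow db vb)
  ... | top , below = below , trans top (trans (cong₂ _⊗_ (toPol-leading da va) (toPol-leading db vb)) (FR.*-identityˡ 1#))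

  _*ₘ_ : Monic → Monic → Monic
  a *ₘ b = (deg a + deg b) , lowerCoeffs (deg a + deg b) (toPol a *ₚ toPol b)

  *ₘ-toPol : ∀ a b → toPol (a *ₘ b) ≈ₚ (toPol a *ₚ toPol b)
  *ₘ-toPol a b = monic-from (deg a + deg b) _ (proj₁ (monic-* a b)) (proj₂ (monic-* a b))

  InP-*⇔ : ∀ n a b → InP n (toPol a *ₚ toPol b) ⇔ (deg a + deg b ≤ n)
  InP-*⇔ n a b = mk⇔ to ((λ le → a *ₘ b , le , *ₘ-toPol a b))
    where
    to : InP n (toPol a *ₚ toPol b) → deg a + deg b ≤ n
    to (m , le , e) = subst (_≤ n) (cong proj₁ (toPol-injective m (a *ₘ b) (λ i → trans (e i) (sym (*ₘ-toPol a b i))))) le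

module Coprimality (F : FiniteField) where
  open Field F
  open PolyRing F
  open Degrees F
  open Poly F
  open import Algebra.Properties.AbelianGroup FR.+-abelianGroup using (xyx⁻¹≈y)

  ∣ₚ-resp : ∀ h p p′ → h ∣ₚ p → p ≈ₚ p′ → h ∣ₚ p′
  ∣ₚ-resp h p p′ (g , e) f = g , (λ i → trans (e i) (f i))

  ∣ₚ-refl : ∀ h → h ∣ₚ h
  ∣ₚ-refl h = oneₚ , *ₚ-identityʳ h

  ∣ₚ-zero : ∀ h → h ∣ₚ []
  ∣ₚ-zero h = [] , *ₚ-zeroʳ h [] (λ _ → refl)

  ∣ₚ-+ : ∀ h p r → h ∣ₚ p → h ∣ₚ r → h ∣ₚ (p +ₚ r)
  ∣ₚ-+ h p r (g₁ , e₁) (g₂ , e₂) = (g₁ +ₚ g₂) ,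
    λ i → trans (*ₚ-distribˡ h g₁ g₂ i) (+ₚ-cong {h *ₚ g₁} {p} {h *ₚ g₂} {r} e₁ e₂ i)

  ∣ₚ-*ˡ : ∀ h p Q → h ∣ₚ p → h ∣ₚ (Q *ₚ p)
  ∣ₚ-*ˡ h p Q (g , e) = (Q *ₚ g) , λ i → begin
    coeff (h *ₚ (Q *ₚ g)) i   ≡⟨ sym (*ₚ-assoc h Q g i) ⟩
    coeff ((h *ₚ Q) *ₚ g) i   ≡⟨ *ₚ-congˡ {h *ₚ Q} {Q *ₚ h} g (*ₚ-comm h Q) i ⟩
    coeff ((Q *ₚ h) *ₚ g) i   ≡⟨ *ₚ-assoc Q h g i ⟩
    coeff (Q *ₚ (h *ₚ g)) i   ≡⟨ *ₚ-congʳ Q {h *ₚ g} {p} e i ⟩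
    coeff (Q *ₚ p) i ∎
    where open ≡-Reasoning

  ∣ₚ-scale : ∀ h p a → h ∣ₚ p → h ∣ₚ scale a p
  ∣ₚ-scale h p a (g , e) = scale a g , λ i → trans (*ₚ-scale a h g i) (scale-cong a {h *ₚ g} {p} e i)

  Coprime-sym : ∀ p r → Coprime p r ⇔ Coprime r p
  Coprime-sym p r = mk⇔ (λ c h hr hp → c h hp hr) (λ c h hp hr → c h hr hp)

  Coprime-resp : ∀ p p′ r → p ≈ₚ p′ → Coprime p r ⇔ Coprime p′ r
  Coprime-resp p p′ r e = mk⇔
    (λ c h hp′ hr → c h (∣ₚ-resp h p′ p hp′ (sym ∘ e)) hr)
    (λ c h hp hr → c h (∣ₚ-resp h p p′ hp e) hr)

  Coprime-oneˡ : ∀ r → Coprime oneₚ r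
  Coprime-oneˡ r h h∣1 _ = h∣1

  Coprime-oneʳ : ∀ r → Coprime r oneₚ
  Coprime-oneʳ r = Equivalence.to (Coprime-sym oneₚ r) (Coprime-oneˡ r)

  Coprime-shift : ∀ Q c s → Coprime ((Q *ₚ c) +ₚ s) c ⇔ Coprime s c
  Coprime-shift Q c s = mk⇔ to from
    where
    to : Coprime ((Q *ₚ c) +ₚ s) c → Coprime s c
    to cop h hs hc = cop h (∣ₚ-+ h (Q *ₚ c) s (∣ₚ-*ˡ h c Q hc) hs) hc
    cancel : (((Q *ₚ c) +ₚ s) -ₚ (Q *ₚ c)) ≈ₚ s
    cancel i = trans (coeff-- ((Q *ₚ c) +ₚ s) (Q *ₚ c) i)
      (trans (cong (_⊕ ⊝ coeff (Q *ₚ c) i) (coeff-+ (Q *ₚ c) s i)) (xyx⁻¹≈y _ _))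
    from : Coprime s c → Coprime ((Q *ₚ c) +ₚ s) c
    from cop h hb hc = cop h (∣ₚ-resp h (((Q *ₚ c) +ₚ s) -ₚ (Q *ₚ c)) s (∣ₚ-+ h ((Q *ₚ c) +ₚ s) (scale (⊝ 1#) (Q *ₚ c)) hb (∣ₚ-scale h (Q *ₚ c) (⊝ 1#) (∣ₚ-*ˡ h c Q hc))) cancel) hc

  Coprime-scale : ∀ a p r → a ≢ 0# → Coprime (scale a p) r ⇔ Coprime p r
  Coprime-scale a p r nz = mk⇔
    (λ cop h hp hr → cop h (∣ₚ-scale h p a hp) hr)
    (λ cop h hap hr → cop h (∣ₚ-resp h (scale (inv a nz) (scale a p)) p (∣ₚ-scale h (scale a p) (inv a nz) hap) (scale-inv a nz p)) hr)

  ¬Coprime-zero : ∀ (c : Monic) → 1 ≤ deg c → ¬ Coprime (toPol c) []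
  ¬Coprime-zero (suc d , v) _ cop with cop (toPol (suc d , v)) (∣ₚ-refl (toPol (suc d , v))) (∣ₚ-zero (toPol (suc d , v)))
  ... | g , e with zero-or-top g
  ... | inj₁ g≡0 = 0≢1 (trans (sym (*ₚ-zeroʳ (toPol (suc d , v)) g g≡0 0)) (e 0))
  ... | inj₂ (k , gₖ≢0 , below) with top-coeff-* (suc d) k (toPol (suc d , v)) g (toPol-degBelow (suc d) v) below
  ... | top , _ = gₖ≢0 (begin
    coeff g k                                    ≡⟨ sym (FR.*-identityˡ _) ⟩
    1# ⊗ coeff g k                               ≡⟨ cong (_⊗ coeff g k) (sym (toPol-leading (suc d) v)) ⟩
    coeff (toPol (suc d , v)) (suc d) ⊗ coeff g k ≡⟨ sym top ⟩
    coeff (toPol (suc d , v) *ₚ g) (suc d + k)   ≡⟨ e (suc d + k) ⟩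
    coeff oneₚ (suc d + k)                       ≡⟨⟩
    0# ∎)
    where open ≡-Reasoning

-- Euclidean division by a monic c of degree j: the map (Q, s) ↦ Qc + s from
-- (monic Q of degree k) × (s of degree < j) to monic polynomials of degree k + j is
-- injective, hence (both sides having q^(k+j) elements) bijective.
module Division (F : FiniteField) where
  open Field F
  open PolyRing F
  open Degrees F
  open Poly F
  open ListSums
  open import Algebra.Properties.Group FR.+-group using (x∙y⁻¹≈ε⇒x≈y)
  open import Algebra.Properties.CommutativeSemigroup FR.+-commutativeSemigroup
    using () renaming (interchange to ⊕-interchange)

  difference-swap : ∀ x x′ s s′ → x ⊕ s ≡ x′ ⊕ s′ → x ⊕ ⊝ x′ ≡ s′ ⊕ ⊝ s
  difference-swap x x′ s s′ e = begin
    x ⊕ ⊝ x′                    ≡⟨ sym (FR.+-identityʳ _) ⟩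
    (x ⊕ ⊝ x′) ⊕ 0#             ≡⟨ cong ((x ⊕ ⊝ x′) ⊕_) (sym (FR.-‿inverseʳ s)) ⟩
    (x ⊕ ⊝ x′) ⊕ (s ⊕ ⊝ s)      ≡⟨ ⊕-interchange x (⊝ x′) s (⊝ s) ⟩
    (x ⊕ s) ⊕ (⊝ x′ ⊕ ⊝ s)      ≡⟨ cong (_⊕ (⊝ x′ ⊕ ⊝ s)) e ⟩
    (x′ ⊕ s′) ⊕ (⊝ x′ ⊕ ⊝ s)    ≡⟨ ⊕-interchange x′ s′ (⊝ x′) (⊝ s) ⟩
    (x′ ⊕ ⊝ x′) ⊕ (s′ ⊕ ⊝ s)    ≡⟨ cong (_⊕ (s′ ⊕ ⊝ s)) (FR.-‿inverseʳ x′) ⟩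
    0# ⊕ (s′ ⊕ ⊝ s)             ≡⟨ FR.+-identityˡ _ ⟩
    s′ ⊕ ⊝ s ∎
    where open ≡-Reasoning

  small-multiple-zero : ∀ j (c : V j) D → DegBelow j (D *ₚ toPol (j , c)) → AllZero D
  small-multiple-zero j c D small with zero-or-top D
  ... | inj₁ D≡0 = D≡0
  ... | inj₂ (e , Dₑ≢0 , below) = ⊥-elim (Dₑ≢0 (begin
    coeff D e                                ≡⟨ sym (FR.*-identityʳ _) ⟩
    coeff D e ⊗ 1#                           ≡⟨ cong (coeff D e ⊗_) (sym (toPol-leading j c)) ⟩
    coeff D e ⊗ coeff (toPol (j , c)) j      ≡⟨ sym (proj₁ (top-coeff-* e j D (toPol (j , c)) below (toPol-degBelow j c))) ⟩
    coeff (D *ₚ toPol (j , c)) (e + j)       ≡⟨ small (e + j) (m≤n+m j e) ⟩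
    0# ∎))
    where open ≡-Reasoning

  module EuclideanDivision (j : ℕ) (c : V j) where
    C : Pol
    C = toPol (j , c)

    combine : ∀ k → V k × V j → Pol
    combine k (Q , s) = (toPol (k , Q) *ₚ C) +ₚ toList s

    combine-degBelow : ∀ k Qs → DegBelow (suc (k + j)) (combine k Qs)
    combine-degBelow k (Q , s) = degBelow-+ (suc (k + j)) (toPol (k , Q) *ₚ C) (toList s)
      (proj₁ (monic-* (k , Q) (j , c))) (λ m le → toList-degBelow j s m (≤-trans (m≤n+m j k) (<⇒≤ le)))

    combine-leading : ∀ k Qs → coeff (combine k Qs) (k + j) ≡ 1#
    combine-leading k (Q , s) = trans (coeff-+ (toPol (k , Q) *ₚ C) (toList s) (k + j))
      (trans (cong₂ _⊕_ (proj₂ (monic-* (k , Q) (j , c))) (toList-degBelow j s (k + j) (m≤n+m j k)))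
             (FR.+-identityʳ 1#))

    φ : ∀ k → V k × V j → V (k + j)
    φ k Qs = lowerCoeffs (k + j) (combine k Qs)

    φ-toPol : ∀ k Qs → toPol (k + j , φ k Qs) ≈ₚ combine k Qs
    φ-toPol k Qs = monic-from (k + j) (combine k Qs) (combine-degBelow k Qs) (combine-leading k Qs)

    combine-difference : ∀ k Q Q′ s s′ → combine k (Q , s) ≈ₚ combine k (Q′ , s′) →
      ((toPol (k , Q) -ₚ toPol (k , Q′)) *ₚ C) ≈ₚ (toList s′ -ₚ toList s)
    combine-difference k Q Q′ s s′ e i = begin
      coeff ((PQ -ₚ PQ′) *ₚ C) i
        ≡⟨ *ₚ-distribʳ PQ (scale (⊝ 1#) PQ′) C i ⟩
      coeff ((PQ *ₚ C) +ₚ (scale (⊝ 1#) PQ′ *ₚ C)) i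
        ≡⟨ coeff-+ (PQ *ₚ C) (scale (⊝ 1#) PQ′ *ₚ C) i ⟩
      coeff (PQ *ₚ C) i ⊕ coeff (scale (⊝ 1#) PQ′ *ₚ C) i
        ≡⟨ cong (coeff (PQ *ₚ C) i ⊕_) (trans (scale-*ₚ (⊝ 1#) PQ′ C i) (coeff-scale-neg (PQ′ *ₚ C) i)) ⟩
      coeff (PQ *ₚ C) i ⊕ ⊝ coeff (PQ′ *ₚ C) i
        ≡⟨ difference-swap _ _ _ _ (trans (sym (coeff-+ (PQ *ₚ C) (toList s) i))
                                          (trans (e i) (coeff-+ (PQ′ *ₚ C) (toList s′) i))) ⟩
      coeff (toList s′) i ⊕ ⊝ coeff (toList s) i
        ≡⟨ sym (coeff-- (toList s′) (toList s) i) ⟩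
      coeff (toList s′ -ₚ toList s) i ∎
      where
      open ≡-Reasoning
      PQ  = toPol (k , Q)
      PQ′ = toPol (k , Q′)

    φ-injective : ∀ k (Qs Qs′ : V k × V j) → φ k Qs ≡ φ k Qs′ → Qs ≡ Qs′
    φ-injective k (Q , s) (Q′ , s′) e = cong₂ _,_ Q≡Q′ s≡s′
      where
      same : combine k (Q , s) ≈ₚ combine k (Q′ , s′)
      same i = trans (sym (φ-toPol k (Q , s) i))
        (trans (cong (λ z → coeff (toPol (k + j , z)) i) e) (φ-toPol k (Q′ , s′) i))
      D = toPol (k , Q) -ₚ toPol (k , Q′)
      D·C≈ = combine-difference k Q Q′ s s′ same
      D≡0 : AllZero D
      D≡0 = small-multiple-zero j c D (λ m le → trans (D·C≈ m)
        (trans (coeff-- (toList s′) (toList s) m)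
          (trans (cong₂ (λ u v → u ⊕ ⊝ v) (toList-degBelow j s′ m le) (toList-degBelow j s m le)) (FR.-‿inverseʳ 0#))))
      Q≡Q′ : Q ≡ Q′
      Q≡Q′ = toPol-injective-≡deg k Q Q′
        (λ i → x∙y⁻¹≈ε⇒x≈y _ _ (trans (sym (coeff-- (toPol (k , Q)) (toPol (k , Q′)) i)) (D≡0 i)))
      s≡s′ : s ≡ s′
      s≡s′ = toList-injective j s s′ (λ i → sym (x∙y⁻¹≈ε⇒x≈y _ _
        (trans (sym (coeff-- (toList s′) (toList s) i)) (trans (sym (D·C≈ i)) (*ₚ-zeroˡ D C D≡0 i)))))

    pairs : ∀ k → List (V k × V j)
    pairs k = cartesianProduct (vectors k) (vectors j)

    image : ∀ k → List (V (k + j))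
    image k = map (φ k) (pairs k)

    image-unique : ∀ k → Unique (image k)
    image-unique k = map⁺ (λ {x} {y} → φ-injective k x y) (cartesianProduct⁺ (vectors-unique k) (vectors-unique j))

    image-length : ∀ k → length (image k) ≡ length (vectors (k + j))
    image-length k = begin
      length (map (φ k) (pairs k))               ≡⟨ length-map (φ k) (pairs k) ⟩
      length (pairs k)                           ≡⟨ length-cp (vectors k) (vectors j) ⟩
      length (vectors k) * length (vectors j)    ≡⟨ cong₂ _*_ (vectors-length k) (vectors-length j) ⟩
      q ^ k * q ^ j                              ≡⟨ sym (^-distribˡ-+-* q k j) ⟩
      q ^ (k + j)                                ≡⟨ sym (vectors-length (k + j)) ⟩
      length (vectors (k + j)) ∎
      where open ≡-Reasoning

    image-complete : ∀ k (b : V (k + j)) → b ∈ image k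
    image-complete k b = pigeonhole (image k) (vectors (k + j)) (image-unique k) (vectors-unique (k + j))
      (λ {z} _ → vectors-complete (k + j) z) (image-length k) (vectors-complete (k + j) b)

    divide : ∀ k (b : V (k + j)) → ∃ λ Qs → b ≡ φ k Qs
    divide k b with ∈-map⁻ (φ k) (image-complete k b)
    ... | Qs , _ , e = Qs , e

    count-by-division : ∀ k (f : V (k + j) → Bool) → count f (vectors (k + j)) ≡ count (f ∘ φ k) (pairs k)
    count-by-division k f = trans
      (sym (sumL-same-members _ (image k) (vectors (k + j)) (image-unique k) (vectors-unique (k + j))
             (λ {z} _ → vectors-complete (k + j) z) (λ {z} _ → image-complete k z)))
      (sumL-map _ (φ k) (pairs k))

-- Coprimality of monic polynomials is decidable, by the Euclidean algorithm:
-- gcd(b, c) = gcd(b mod c, c), and a nonzero remainder may be made monic.  Recursion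
-- is on a bound for deg b + deg c.
module CoprimeDecision (F : FiniteField) where
  open Field F
  open PolyRing F
  open Degrees F
  open Coprimality F
  open Division F
  open EuclideanDivision using (φ; φ-toPol; combine; divide)
  open Poly F

  -- Coprimality of a remainder s (degree < m) with c, given the decision for monic
  -- polynomials of degree < m: s is zero, or a nonzero scalar times such a monic.
  coprime?-remainder : ∀ m (s : V m) j (c : V j) →
    (∀ e (s′ : V e) → e < m → Dec (Coprime (toPol (e , s′)) (toPol (j , c)))) →
    Dec (Coprime (toList s) (toPol (j , c)))
  coprime?-remainder m s j c rec with zero-or-top (toList s)
  coprime?-remainder m s zero    [] rec | inj₁ s≡0 = yes (Coprime-oneʳ (toList s))
  coprime?-remainder m s (suc j) c  rec | inj₁ s≡0 = no λ cop →
    ¬Coprime-zero (suc j , c) (s≤s z≤n)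
      (Equivalence.to (Coprime-sym [] (toPol (suc j , c))) (Equivalence.to (Coprime-resp (toList s) [] (toPol (suc j , c)) s≡0) cop))
  coprime?-remainder m s j c rec | inj₂ (e , lead≢0 , below) =
    Dec-map (⇔.trans (Coprime-resp (toPol (e , s′)) normalised C s′-toPol) (Coprime-scale λ⁻¹ (toList s) C (inv-nonzero λ₀ lead≢0)))
            (rec e s′ e<m)
    where
    C = toPol (j , c)
    λ₀ = coeff (toList s) e
    λ⁻¹ = inv λ₀ lead≢0
    normalised = scale λ⁻¹ (toList s)
    s′ = lowerCoeffs e normalised
    e<m : e < m
    e<m with m ≤? e
    ... | yes m≤e = ⊥-elim (lead≢0 (toList-degBelow m s e m≤e))
    ... | no  m≰e = ≰⇒> m≰e
    s′-toPol : toPol (e , s′) ≈ₚ normalised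
    s′-toPol = monic-from e normalised (degBelow-scale (suc e) λ⁻¹ (toList s) below)
                 (trans (coeff-scale λ⁻¹ (toList s) e) (inv-l λ₀ lead≢0))

  mutual
    coprime?-bounded : (n : ℕ) → ∀ i (b : V i) j (c : V j) → i + j < n → Dec (Coprime (toPol (i , b)) (toPol (j , c)))
    coprime?-bounded (suc n) i b j c (s≤s lt) with j ≤? i
    ... | yes j≤i = coprime?-reduce n (i ∸ j) j b c (m∸n+n≡m j≤i) lt
    ... | no  j≰i = Dec-map (Coprime-sym (toPol (j , c)) (toPol (i , b)))
                      (coprime?-reduce n (j ∸ i) i c b (m∸n+n≡m (<⇒≤ (≰⇒> j≰i))) (subst (_≤ n) (+-comm i j) lt))

    coprime?-reduce : (n : ℕ) → ∀ k j {i} (b : V i) (c : V j) → k + j ≡ i → i + j ≤ n →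
      Dec (Coprime (toPol (i , b)) (toPol (j , c)))
    coprime?-reduce n k zero     b [] _    _  = yes (Coprime-oneʳ (toPol (_ , b)))
    coprime?-reduce n k (suc j′) b c  refl lt with divide (suc j′) c k b
    ... | (Q , s) , refl =
      Dec-map (⇔.sym (⇔.trans (Coprime-resp (toPol (k + suc j′ , φ (suc j′) c k (Q , s))) (combine (suc j′) c k (Q , s))
                                            (toPol (suc j′ , c)) (φ-toPol (suc j′) c k (Q , s)))
                              (Coprime-shift (toPol (k , Q)) (toPol (suc j′ , c)) (toList s))))
        (coprime?-remainder (suc j′) s (suc j′) c λ e s′ e<j →
           coprime?-bounded n e s′ (suc j′) c (<-≤-trans (+-monoˡ-< (suc j′) (<-≤-trans e<j (m≤n+m (suc j′) k))) lt))

  coprime? : ∀ i (b : V i) j (c : V j) → Dec (Coprime (toPol (i , b)) (toPol (j , c)))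
  coprime? i b j c = coprime?-bounded (suc (i + j)) i b j c ≤-refl

  coprime?ʳ : ∀ m (s : V m) j (c : V j) → Dec (Coprime (toList s) (toPol (j , c)))
  coprime?ʳ m s j c = coprime?-remainder m s j c (λ e s′ _ → coprime? e s′ j c)

-- The counts C(i,j) of coprime monic pairs of degrees (i,j), via the auxiliary counts
-- R(m,j) of pairs (c, s) with c monic of degree j, s of degree < m, and gcd(s,c) = 1.
--   * division by c:            C(k+j, j) = qᵏ·R(j,j)
--   * top coefficient of s:     R(m+1, j) = R(m, j) + (q−1)·C(m, j)
-- together give C(t,t) = 1 for t = 0 and (q−1)q^(2t−1) otherwise.
module CoprimeCounts (F : FiniteField) where
  open Field F
  open PolyRing F
  open Degrees F
  open Coprimality F
  open Division F
  open CoprimeDecision F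
  open Poly F
  open ListSums
  open import Data.Vec using (_∷ʳ_)
  open import Data.Nat.Induction using (<-rec)
  open import Algebra.Properties.CommutativeSemigroup *-commutativeSemigroup using () renaming (x∙yz≈y∙xz to *-left-comm)

  coprimeTest : ∀ i j → V i × V j → Bool
  coprimeTest i j (b , c) = does (coprime? i b j c)

  coprimeCount : ℕ → ℕ → ℕ
  coprimeCount i j = count (coprimeTest i j) (cartesianProduct (vectors i) (vectors j))

  remainderTest : ∀ m j → V j × V m → Bool
  remainderTest m j (c , s) = does (coprime?ʳ m s j c)

  remainderCount : ℕ → ℕ → ℕ
  remainderCount m j = count (remainderTest m j) (cartesianProduct (vectors j) (vectors m))

  coprimeCount-sym : ∀ i j → coprimeCount i j ≡ coprimeCount j i
  coprimeCount-sym i j = trans (sumL-cp-swap _ (vectors i) (vectors j))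
    (sumL-ext _ _ (cartesianProduct (vectors j) (vectors i))
      (λ { (c , b) → cong bit (does-⇔ (Coprime-sym (toPol (i , b)) (toPol (j , c))) (coprime? i b j c) (coprime? j c i b)) }))

  coprimeRemainders : ∀ m {j} → V j → ℕ
  coprimeRemainders m {j} c = count (λ s → remainderTest m j (c , s)) (vectors m)

  coprimeMonics : ∀ m {j} → V j → ℕ
  coprimeMonics m {j} c = count (λ v → coprimeTest m j (v , c)) (vectors m)

  coprimeCount-by-c : ∀ m j → coprimeCount m j ≡ sumL (coprimeMonics m) (vectors j)
  coprimeCount-by-c m j = trans (sumL-cp-swap _ (vectors m) (vectors j)) (sumL-cp _ (vectors j) (vectors m))

  -- for fixed c, every monic b of degree k + j is Qc + s, and gcd(Qc + s, c) = gcd(s, c)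
  coprimeMonics-division : ∀ k {j} (c : V j) → coprimeMonics (k + j) c ≡ q ^ k * coprimeRemainders j c
  coprimeMonics-division k {j} c = begin
    coprimeMonics (k + j) c
      ≡⟨ count-by-division c k (λ b → coprimeTest (k + j) j (b , c)) ⟩
    count (λ Qs → coprimeTest (k + j) j (φ c k Qs , c)) (pairs c k)
      ≡⟨ sumL-ext _ _ (pairs c k) (λ { (Q , s) → cong bit (does-⇔
           (⇔.trans (Coprime-resp (toPol (k + j , φ c k (Q , s))) (combine c k (Q , s)) (toPol (j , c)) (φ-toPol c k (Q , s)))
                    (Coprime-shift (toPol (k , Q)) (toPol (j , c)) (toList s)))
           (coprime? (k + j) (φ c k (Q , s)) j c) (coprime?ʳ j s j c)) }) ⟩
    count (λ Qs → true ∧ remainderTest j j (c , proj₂ Qs)) (pairs c k)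
      ≡⟨ count-cp (λ _ → true) (λ s → remainderTest j j (c , s)) (vectors k) (vectors j) ⟩
    count (λ _ → true) (vectors k) * coprimeRemainders j c
      ≡⟨ cong (_* coprimeRemainders j c) (trans (sym (length-as-count (vectors k))) (vectors-length k)) ⟩
    q ^ k * coprimeRemainders j c ∎
    where
    open ≡-Reasoning
    open EuclideanDivision j

  coprimeCount-division : ∀ k j → coprimeCount (k + j) j ≡ q ^ k * remainderCount j j
  coprimeCount-division k j = begin
    coprimeCount (k + j) j                              ≡⟨ coprimeCount-by-c (k + j) j ⟩
    sumL (coprimeMonics (k + j)) (vectors j)            ≡⟨ sumL-ext _ _ (vectors j) (coprimeMonics-division k) ⟩
    sumL (λ c → q ^ k * coprimeRemainders j c) (vectors j) ≡⟨ sumL-scale (q ^ k) _ (vectors j) ⟩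
    q ^ k * sumL (coprimeRemainders j) (vectors j)      ≡⟨ cong (q ^ k *_) (sym (sumL-cp _ (vectors j) (vectors j))) ⟩
    q ^ k * remainderCount j j ∎
    where open ≡-Reasoning

  -- R(0,0) = 1: the constant 0 is coprime to 1
  remainderCount-0-0 : remainderCount 0 0 ≡ 1
  remainderCount-0-0 = cong (λ b → bit b + 0) (dec-true (coprime?ʳ 0 [] 0 []) (Coprime-oneʳ []))

  -- R(0, j+1) = 0: the constant 0 is not coprime to c of positive degree
  remainderCount-0-suc : ∀ j → remainderCount 0 (suc j) ≡ 0
  remainderCount-0-suc j = trans (sumL-ext _ (λ _ → 0) (cartesianProduct (vectors (suc j)) (vectors 0)) never)
    (trans (sumL-const 0 (cartesianProduct (vectors (suc j)) (vectors 0))) (*-zeroʳ (length (cartesianProduct (vectors (suc j)) (vectors 0)))))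
    where
    never : ∀ cs → bit (remainderTest 0 (suc j) cs) ≡ 0
    never (c , []) = cong bit (dec-false (coprime?ʳ 0 [] (suc j) c)
      (¬Coprime-zero (suc j , c) (s≤s z≤n) ∘ Equivalence.to (Coprime-sym [] (toPol (suc j , c)))))

  -- a remainder with top coefficient 0 is a remainder of smaller degree
  toList-snoc-0 : ∀ {m} (v : V m) → toList (v ∷ʳ 0#) ≈ₚ toList v
  toList-snoc-0 []      zero    = refl
  toList-snoc-0 []      (suc i) = refl
  toList-snoc-0 (x ∷ v) zero    = refl
  toList-snoc-0 (x ∷ v) (suc i) = toList-snoc-0 v i

  toList-snoc-nonzero : ∀ {m} a (na : a ≢ 0#) (v : V m) →
    toList (v ∷ʳ a) ≈ₚ scale a (toPol (m , scaleV (inv a na) v))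
  toList-snoc-nonzero a na []      zero    = sym (FR.*-identityʳ a)
  toList-snoc-nonzero a na []      (suc i) = refl
  toList-snoc-nonzero a na (x ∷ v) zero    = sym (inv-cancelʳ a na x)
  toList-snoc-nonzero a na (x ∷ v) (suc i) = toList-snoc-nonzero a na v i

  -- Splitting the remainders of length m+1 by their top coefficient a: a = 0 leaves a
  -- remainder of length m, and a ≠ 0 gives a times a monic of degree m (q − 1 choices).
  coprimeRemainders-suc : ∀ m {j} (c : V j) →
    coprimeRemainders (suc m) c + coprimeMonics m c ≡ coprimeRemainders m c + q * coprimeMonics m c
  coprimeRemainders-suc m {j} c = begin
    coprimeRemainders (suc m) c + coprimeMonics m c
      ≡⟨ cong (_+ coprimeMonics m c) (trans (sumL-map _ snoc (cartesianProduct elements (vectors m)))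
                                            (sumL-cp _ elements (vectors m))) ⟩
    sumL with-top elements + coprimeMonics m c
      ≡⟨ sumL-split-at with-top _ _ elements elements-unique (elements-complete 0#) top-zero top-nonzero ⟩
    coprimeRemainders m c + length elements * coprimeMonics m c
      ≡⟨ cong (λ z → coprimeRemainders m c + z * coprimeMonics m c) elements-length ⟩
    coprimeRemainders m c + q * coprimeMonics m c ∎
    where
    open ≡-Reasoning
    with-top : Carrier → ℕ
    with-top a = count (λ v → remainderTest (suc m) j (c , snoc (a , v))) (vectors m)
    top-zero : with-top 0# ≡ coprimeRemainders m c
    top-zero = sumL-ext _ _ (vectors m) (λ v → cong bit (does-⇔
      (Coprime-resp (toList (v ∷ʳ 0#)) (toList v) (toPol (j , c)) (toList-snoc-0 v))
      (coprime?ʳ (suc m) (v ∷ʳ 0#) j c) (coprime?ʳ m v j c)))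
    top-nonzero : ∀ a → a ≢ 0# → with-top a ≡ coprimeMonics m c
    top-nonzero a na = trans
      (sumL-ext _ _ (vectors m) (λ v → cong bit (does-⇔
        (⇔.trans (Coprime-resp (toList (v ∷ʳ a)) (scale a (toPol (m , scaleV (inv a na) v))) (toPol (j , c)) (toList-snoc-nonzero a na v))
                 (Coprime-scale a (toPol (m , scaleV (inv a na) v)) (toPol (j , c)) na))
        (coprime?ʳ (suc m) (v ∷ʳ a) j c) (coprime? m (scaleV (inv a na) v) j c))))
      (sumL-bijection (λ w → bit (coprimeTest m j (w , c))) (scaleV (inv a na)) (scaleV a) (vectors m)
        (vectors-unique m) (vectors-complete m) (scaleV-inv a na) (scaleV-inv′ a na))

  remainderCount-step : ∀ m j → remainderCount (suc m) j + coprimeCount m j ≡ remainderCount m j + q * coprimeCount m j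
  remainderCount-step m j = begin
    remainderCount (suc m) j + coprimeCount m j
      ≡⟨ cong₂ _+_ (sumL-cp _ (vectors j) (vectors (suc m))) (coprimeCount-by-c m j) ⟩
    sumL (coprimeRemainders (suc m)) (vectors j) + sumL (coprimeMonics m) (vectors j)
      ≡⟨ sym (sumL-+ (coprimeRemainders (suc m)) (coprimeMonics m) (vectors j)) ⟩
    sumL (λ c → coprimeRemainders (suc m) c + coprimeMonics m c) (vectors j)
      ≡⟨ sumL-ext _ _ (vectors j) (coprimeRemainders-suc m) ⟩
    sumL (λ c → coprimeRemainders m c + q * coprimeMonics m c) (vectors j)
      ≡⟨ sumL-+ (coprimeRemainders m) (λ c → q * coprimeMonics m c) (vectors j) ⟩
    sumL (coprimeRemainders m) (vectors j) + sumL (λ c → q * coprimeMonics m c) (vectors j)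
      ≡⟨ cong₂ _+_ (sym (sumL-cp _ (vectors j) (vectors m))) (trans (sumL-scale q _ (vectors j)) (cong (q *_) (sym (coprimeCount-by-c m j)))) ⟩
    remainderCount m j + q * coprimeCount m j ∎
    where open ≡-Reasoning

  remainderCount-suc : ∀ m j → remainderCount (suc m) j ≡ remainderCount m j + p * coprimeCount m j
  remainderCount-suc m j = +-cancelʳ-≡ (coprimeCount m j) _ _ (begin
    remainderCount (suc m) j + C                 ≡⟨ remainderCount-step m j ⟩
    remainderCount m j + q * C                   ≡⟨ cong (λ z → remainderCount m j + z * C) q≡1+p ⟩
    remainderCount m j + (C + p * C)             ≡⟨ cong (remainderCount m j +_) (+-comm C (p * C)) ⟩
    remainderCount m j + (p * C + C)             ≡⟨ sym (+-assoc (remainderCount m j) (p * C) C) ⟩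
    remainderCount m j + p * C + C ∎)
    where
    open ≡-Reasoning
    C = coprimeCount m j

  coprimeCount-above : ∀ k j {i} → k + j ≡ i → coprimeCount i j ≡ q ^ k * remainderCount j j
  coprimeCount-above k j refl = coprimeCount-division k j

  coprimeCount-below : ∀ m o {j} → o + m ≡ j → coprimeCount m j ≡ q ^ o * remainderCount m m
  coprimeCount-below m o refl = trans (coprimeCount-sym m (o + m)) (coprimeCount-division o m)

  -- the common value of C(t,t) and R(t,t)
  diagonal : ℕ → ℕ
  diagonal zero    = 1
  diagonal (suc t) = p * q ^ suc (t + t)

  remainderCount-below : ∀ j → (∀ {m} → m < j → remainderCount m m ≡ diagonal m) →
    ∀ m → m < j → remainderCount (suc m) j ≡ p * q ^ (m + j)
  remainderCount-below (suc j) diag zero _ = begin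
    remainderCount 1 (suc j)                           ≡⟨ remainderCount-suc 0 (suc j) ⟩
    remainderCount 0 (suc j) + p * coprimeCount 0 (suc j)
      ≡⟨ cong₂ (λ u v → u + p * v) (remainderCount-0-suc j) (coprimeCount-below 0 (suc j) (+-identityʳ (suc j))) ⟩
    p * (q ^ suc j * remainderCount 0 0)               ≡⟨ cong (λ z → p * (q ^ suc j * z)) remainderCount-0-0 ⟩
    p * (q ^ suc j * 1)                                ≡⟨ cong (p *_) (*-identityʳ _) ⟩
    p * q ^ suc j ∎
    where open ≡-Reasoning
  remainderCount-below j diag (suc m) m+1<j with m≤n⇒∃[o]m+o≡n (<⇒≤ m+1<j)
  ... | o , refl = begin
    remainderCount (suc (suc m)) j                     ≡⟨ remainderCount-suc (suc m) j ⟩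
    remainderCount (suc m) j + p * coprimeCount (suc m) j
      ≡⟨ cong₂ (λ u v → u + p * v) (remainderCount-below j diag m (<⇒≤ m+1<j)) off-diagonal ⟩
    p * Y + p * (p * Y)                                ≡⟨ sym (*-distribˡ-+ p Y (p * Y)) ⟩
    p * (Y + p * Y)                                    ≡⟨ cong (λ z → p * (z * Y)) (sym q≡1+p) ⟩
    p * q ^ (suc m + j) ∎
    where
    open ≡-Reasoning
    Y = q ^ (m + j)
    exponent : ∀ m o → o + suc (m + m) ≡ m + (suc m + o)
    exponent = solve-∀
    off-diagonal : coprimeCount (suc m) j ≡ p * Y
    off-diagonal = begin
      coprimeCount (suc m) j                  ≡⟨ coprimeCount-below (suc m) o (+-comm o (suc m)) ⟩
      q ^ o * remainderCount (suc m) (suc m)  ≡⟨ cong (q ^ o *_) (diag m+1<j) ⟩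
      q ^ o * (p * q ^ suc (m + m))           ≡⟨ *-left-comm (q ^ o) p _ ⟩
      p * (q ^ o * q ^ suc (m + m))           ≡⟨ cong (p *_) (sym (^-distribˡ-+-* q o (suc (m + m)))) ⟩
      p * q ^ (o + suc (m + m))               ≡⟨ cong (λ z → p * q ^ z) (exponent m o) ⟩
      p * Y ∎

  remainderCount-diagonal : ∀ t → remainderCount t t ≡ diagonal t
  remainderCount-diagonal = <-rec _ step
    where
    step : ∀ t → (∀ {m} → m < t → remainderCount m m ≡ diagonal m) → remainderCount t t ≡ diagonal t
    step zero    _    = remainderCount-0-0
    step (suc t) diag = trans (remainderCount-below (suc t) diag t ≤-refl) (cong (λ z → p * q ^ z) (+-suc t t))

  coprimeCount-diagonal : ∀ t → coprimeCount t t ≡ diagonal t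
  coprimeCount-diagonal t = trans (coprimeCount-division 0 t) (trans (+-identityʳ _) (remainderCount-diagonal t))

  coprimeCount-suc : ∀ t j → j ≤ t → coprimeCount (suc t) j ≡ q * coprimeCount t j
  coprimeCount-suc t j j≤t with m≤n⇒∃[o]m+o≡n j≤t
  ... | o , refl = begin
    coprimeCount (suc (j + o)) j             ≡⟨ coprimeCount-above (suc o) j (cong suc (+-comm o j)) ⟩
    q * q ^ o * remainderCount j j          ≡⟨ *-assoc q (q ^ o) _ ⟩
    q * (q ^ o * remainderCount j j)        ≡⟨ cong (q *_) (sym (coprimeCount-above o j (+-comm o j))) ⟩
    q * coprimeCount (j + o) j ∎
    where open ≡-Reasoning

  row-total : ∀ t → Σ≤ t (coprimeCount t) ≡ q ^ (t + t)
  row-total zero    = coprimeCount-diagonal 0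
  row-total (suc t) = begin
    Σ≤ t (coprimeCount (suc t)) + coprimeCount (suc t) (suc t)
      ≡⟨ cong₂ _+_ (trans (Σ≤-ext≤ t _ _ (coprimeCount-suc t)) (Σ≤-scale t q (coprimeCount t))) (coprimeCount-diagonal (suc t)) ⟩
    q * Σ≤ t (coprimeCount t) + p * q ^ suc (t + t)
      ≡⟨ cong (λ z → q * z + p * q ^ suc (t + t)) (row-total t) ⟩
    q ^ suc (t + t) + p * q ^ suc (t + t)
      ≡⟨ cong (_* q ^ suc (t + t)) (sym q≡1+p) ⟩
    q * q ^ suc (t + t)
      ≡⟨ cong (λ z → q ^ suc z) (sym (+-suc t t)) ⟩
    q ^ (suc t + suc t) ∎
    where open ≡-Reasoning

  -- D(t): the number of coprime monic pairs (b,c) with max(deg b, deg c) = t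
  maxDegreeCount : ℕ → ℕ
  maxDegreeCount t = Σ≤ t (coprimeCount t) + Σ< t (λ i → coprimeCount i t)

  maxDegreeClosed : ℕ → ℕ
  maxDegreeClosed zero    = 1
  maxDegreeClosed (suc t) = q ^ suc (t + t) * (q + 1)

  maxDegreeCount-closed : ∀ t → maxDegreeCount t ≡ maxDegreeClosed t
  maxDegreeCount-closed zero    = coprimeCount-diagonal 0
  maxDegreeCount-closed (suc t) = begin
    Σ≤ (suc t) (coprimeCount (suc t)) + Σ≤ t (λ i → coprimeCount i (suc t))
      ≡⟨ cong₂ _+_ (row-total (suc t)) (trans (Σ≤-ext t _ _ (λ i → coprimeCount-sym i (suc t)))
                                      (trans (Σ≤-ext≤ t _ _ (coprimeCount-suc t)) (Σ≤-scale t q (coprimeCount t)))) ⟩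
    q ^ (suc t + suc t) + q * Σ≤ t (coprimeCount t)
      ≡⟨ cong₂ (λ u v → q ^ u + q * v) (cong suc (+-suc t t)) (row-total t) ⟩
    q * Y + Y
      ≡⟨ cong (q * Y +_) (sym (*-identityˡ Y)) ⟩
    q * Y + 1 * Y
      ≡⟨ sym (*-distribʳ-+ Y q 1) ⟩
    (q + 1) * Y
      ≡⟨ *-comm (q + 1) Y ⟩
    Y * (q + 1) ∎
    where
    open ≡-Reasoning
    Y = q ^ suc (t + t)

module StepIdentities where

  ΣDM-step : ∀ p m E → .{{NonZero p}} → p * E + 1 ≡ suc p * ((p * m + 1) * (p * m + 1)) →
    E + suc p * (m * m) ≡ (1 + suc p * m) * (1 + suc p * m)
  ΣDM-step p m E h = *-cancelˡ-≡ _ _ p (+-cancelʳ-≡ 1 _ _ (begin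
    p * (E + suc p * (m * m)) + 1                          ≡⟨ expand p m E ⟩
    (p * E + 1) + p * suc p * (m * m)                      ≡⟨ cong (_+ p * suc p * (m * m)) h ⟩
    suc p * ((p * m + 1) * (p * m + 1)) + p * suc p * (m * m) ≡⟨ square p m ⟩
    p * ((1 + suc p * m) * (1 + suc p * m)) + 1 ∎))
    where
    open ≡-Reasoning
    expand : ∀ p m E → p * (E + suc p * (m * m)) + 1 ≡ (p * E + 1) + p * suc p * (m * m)
    expand = solve-∀
    square : ∀ p m → suc p * ((p * m + 1) * (p * m + 1)) + p * suc p * (m * m) ≡ p * ((1 + suc p * m) * (1 + suc p * m)) + 1
    square = solve-∀

  -- The inductive step for ΣDM², with q = 1 + p, m = M(n), Y = q^(2n+1), S = ΣDM²(n),
  -- E = ΣD(n).  Both sides are enlarged by K = q²·m(2 + 3pm) + p so that the closed form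
  -- at n, p·E + 1 = Y and q·Y = (pm + 1)² can be substituted.
  ΣDM²-step : ∀ p n m Y S E →
    p * p * S + m * (2 + 3 * p * m) ≡ (n + 1) * Y * (suc p + 1) →
    p * E + 1 ≡ Y →
    suc p * Y ≡ (p * m + 1) * (p * m + 1) →
    p * p * (E + 2 * suc p * (m * m) + suc p * suc p * S + Y * (suc p + 1)) + (1 + suc p * m) * (2 + 3 * p * (1 + suc p * m))
      ≡ (suc n + 1) * (suc p * suc p * Y) * (suc p + 1)
  ΣDM²-step p n m Y S E IH hE hY = +-cancelʳ-≡ K _ _ (begin
    LHS + K
      ≡⟨ expand p m Y S E A ⟩
    (p * p * E + p) + q * q * (p * p * S + m * (2 + 3 * p * m)) + (2 * q * p * p * (m * m) + p * p * Y * (q + 1) + A)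
      ≡⟨ cong₂ (λ u v → u + q * q * v + (2 * q * p * p * (m * m) + p * p * Y * (q + 1) + A)) hE′ IH ⟩
    p * Y + q * q * ((n + 1) * Y * (q + 1)) + (2 * q * p * p * (m * m) + p * p * Y * (q + 1) + A)
      ≡⟨ collect p n m Y A ⟩
    T + (p * q * (q * Y) + 2 * q * p * p * (m * m) + A)
      ≡⟨ cong (λ z → T + (p * q * z + 2 * q * p * p * (m * m) + A)) hY ⟩
    T + (p * q * ((p * m + 1) * (p * m + 1)) + 2 * q * p * p * (m * m) + A)
      ≡⟨ cong (T +_) (core p m) ⟩
    T + (q * (q + 1) * ((p * m + 1) * (p * m + 1)) + K)
      ≡⟨ cong (λ z → T + (q * (q + 1) * z + K)) (sym hY) ⟩
    T + (q * (q + 1) * (q * Y) + K)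
      ≡⟨ finish p n Y K ⟩
    (suc n + 1) * (q * q * Y) * (q + 1) + K ∎)
    where
    open ≡-Reasoning
    q = suc p
    A = (1 + q * m) * (2 + 3 * p * (1 + q * m))
    K = q * q * (m * (2 + 3 * p * m)) + p
    T = (n + 1) * (q * q * Y) * (q + 1)
    LHS = p * p * (E + 2 * q * (m * m) + q * q * S + Y * (q + 1)) + A
    hE′ : p * p * E + p ≡ p * Y
    hE′ = trans (distrib p E) (cong (p *_) hE)
      where
      distrib : ∀ p E → p * p * E + p ≡ p * (p * E + 1)
      distrib = solve-∀
    expand : ∀ p m Y S E A →
      p * p * (E + 2 * suc p * (m * m) + suc p * suc p * S + Y * (suc p + 1)) + A + (suc p * suc p * (m * (2 + 3 * p * m)) + p)
      ≡ (p * p * E + p) + suc p * suc p * (p * p * S + m * (2 + 3 * p * m)) + (2 * suc p * p * p * (m * m) + p * p * Y * (suc p + 1) + A)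
    expand = solve-∀
    collect : ∀ p n m Y A →
      p * Y + suc p * suc p * ((n + 1) * Y * (suc p + 1)) + (2 * suc p * p * p * (m * m) + p * p * Y * (suc p + 1) + A)
      ≡ (n + 1) * (suc p * suc p * Y) * (suc p + 1) + (p * suc p * (suc p * Y) + 2 * suc p * p * p * (m * m) + A)
    collect = solve-∀
    core : ∀ p m →
      p * suc p * ((p * m + 1) * (p * m + 1)) + 2 * suc p * p * p * (m * m) + (1 + suc p * m) * (2 + 3 * p * (1 + suc p * m))
      ≡ suc p * (suc p + 1) * ((p * m + 1) * (p * m + 1)) + (suc p * suc p * (m * (2 + 3 * p * m)) + p)
    core = solve-∀
    finish : ∀ p n Y K →
      (n + 1) * (suc p * suc p * Y) * (suc p + 1) + (suc p * (suc p + 1) * (suc p * Y) + K)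
      ≡ (suc n + 1) * (suc p * suc p * Y) * (suc p + 1) + K
    finish = solve-∀

  pred-times-pred-triple : ∀ x → (suc x ∸ 1) * (3 * suc x ∸ 1) ≡ x * (2 + 3 * x)
  pred-times-pred-triple = lemma
    where
    lemma : ∀ x → x * (x + (suc x + (suc x + 0))) ≡ x * (2 + 3 * x)
    lemma = solve-∀

  times-p : ∀ p m S R → p * p * S + m * (2 + 3 * p * m) ≡ R → p ^ 3 * S + p * m * (2 + 3 * (p * m)) ≡ R * p
  times-p p m S R h = trans (expand p m S) (trans (cong (p *_) h) (*-comm p R))
    where
    -- p ^ 3 unfolds to p * (p * (p * 1))
    expand : ∀ p m S → p * (p * (p * 1)) * S + p * m * (2 + 3 * (p * m)) ≡ p * (p * p * S + m * (2 + 3 * p * m))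
    expand = solve-∀

  2n+1≡1+n+n : ∀ n → 2 * n + 1 ≡ suc (n + n)
  2n+1≡1+n+n = solve-∀

-- Closed forms, as identities in ℕ with q = 1 + p (no subtraction):
--   M(k) = Σ_{i ≤ k} qⁱ                  p·M(k) + 1 = q^(k+1)
--   ΣD(n) = Σ_{t ≤ n} D(t)               p·ΣD(n) + 1 = q^(2n+1)
--   ΣDM(n) = Σ_{t ≤ n} D(t)·M(n∸t)       ΣDM(n) = M(n)²
--   ΣDM²(n) = Σ_{t ≤ n} D(t)·M(n∸t)²     p²·ΣDM²(n) + M(n)(2 + 3p·M(n)) = (n+1)q^(2n+1)(q+1)
-- Each is proved by induction on n using M(k+1) = 1 + q·M(k); the inductive steps are
-- polynomial identities whose hypotheses are used by cancelling a common summand.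
module ClosedForms (F : FiniteField) where
  open Field F using (q; p; q≡1+p; p-nonZero)
  open CoprimeCounts F using (maxDegreeClosed)
  open ListSums
  open StepIdentities

  M : ℕ → ℕ
  M k = Σ≤ k (q ^_)

  M-suc : ∀ k → M (suc k) ≡ 1 + q * M k
  M-suc zero    = refl
  M-suc (suc k) = trans (cong (_+ q ^ suc (suc k)) (M-suc k))
    (trans (+-assoc 1 (q * M k) _) (cong (1 +_) (sym (*-distribˡ-+ q (M k) (q ^ suc k)))))

  M-geometric : ∀ k → p * M k + 1 ≡ q ^ suc k
  M-geometric zero    = trans (cong (_+ 1) (*-identityʳ p)) (trans (+-comm p 1) (trans (sym q≡1+p) (sym (*-identityʳ q))))
  M-geometric (suc k) = begin
    p * M (suc k) + 1        ≡⟨ cong (λ z → p * z + 1) (M-suc k) ⟩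
    p * (1 + q * M k) + 1    ≡⟨ cong (λ z → p * (1 + z * M k) + 1) q≡1+p ⟩
    p * (1 + suc p * M k) + 1 ≡⟨ step p (M k) ⟩
    suc p * (p * M k + 1)    ≡⟨ cong₂ (λ u v → u * v) (sym q≡1+p) (M-geometric k) ⟩
    q ^ suc (suc k) ∎
    where
    open ≡-Reasoning
    step : ∀ p m → p * (1 + suc p * m) + 1 ≡ suc p * (p * m + 1)
    step = solve-∀

  M-geometric² : ∀ n → q * q ^ suc (n + n) ≡ (p * M n + 1) * (p * M n + 1)
  M-geometric² n = trans (cong (q ^_) (sym (cong suc (+-suc n n))))
    (trans (^-distribˡ-+-* q (suc n) (suc n)) (sym (cong₂ _*_ (M-geometric n) (M-geometric n))))

  convolution-suc : ∀ n (f g : ℕ → ℕ) →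
    Σ≤ (suc n) (λ t → f t * g (suc n ∸ t)) ≡ Σ≤ n (λ t → f t * g (suc (n ∸ t))) + f (suc n) * g 0
  convolution-suc n f g = cong₂ _+_ (Σ≤-ext≤ n _ _ (λ t le → cong (λ z → f t * g z) (+-∸-assoc 1 le)))
                                    (cong (λ z → f (suc n) * g z) (n∸n≡0 n))

  ΣD : ℕ → ℕ
  ΣD n = Σ≤ n maxDegreeClosed

  ΣD-closed : ∀ n → p * ΣD n + 1 ≡ q ^ suc (n + n)
  ΣD-closed zero    = trans (cong (_+ 1) (*-identityʳ p)) (trans (+-comm p 1) (trans (sym q≡1+p) (sym (*-identityʳ q))))
  ΣD-closed (suc n) = begin
    p * (ΣD n + Y * (q + 1)) + 1       ≡⟨ cong (λ z → p * (ΣD n + Y * (z + 1)) + 1) q≡1+p ⟩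
    p * (ΣD n + Y * (suc p + 1)) + 1   ≡⟨ step p (ΣD n) Y ⟩
    (p * ΣD n + 1) + p * Y * (suc p + 1) ≡⟨ cong (_+ p * Y * (suc p + 1)) (ΣD-closed n) ⟩
    Y + p * Y * (suc p + 1)            ≡⟨ step′ p Y ⟩
    suc p * (suc p * Y)                ≡⟨ cong (λ z → z * (z * Y)) (sym q≡1+p) ⟩
    q * (q * Y)                        ≡⟨ cong (λ z → q * (q * q ^ z)) (sym (+-suc n n)) ⟩
    q ^ suc (suc n + suc n) ∎
    where
    open ≡-Reasoning
    Y = q ^ suc (n + n)
    step : ∀ p E Y → p * (E + Y * (suc p + 1)) + 1 ≡ (p * E + 1) + p * Y * (suc p + 1)
    step = solve-∀
    step′ : ∀ p Y → Y + p * Y * (suc p + 1) ≡ suc p * (suc p * Y)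
    step′ = solve-∀

  ΣDM : ℕ → ℕ
  ΣDM n = Σ≤ n (λ t → maxDegreeClosed t * M (n ∸ t))

  ΣDM-suc : ∀ n → ΣDM (suc n) ≡ ΣD n + q * ΣDM n + maxDegreeClosed (suc n)
  ΣDM-suc n = begin
    ΣDM (suc n)
      ≡⟨ convolution-suc n maxDegreeClosed M ⟩
    Σ≤ n (λ t → D t * M (suc (n ∸ t))) + D (suc n) * 1
      ≡⟨ cong₂ _+_ (Σ≤-ext n _ _ (λ t → trans (cong (D t *_) (M-suc (n ∸ t))) (expand (D t) q (M (n ∸ t)))))
                   (*-identityʳ (D (suc n))) ⟩
    Σ≤ n (λ t → D t + q * (D t * M (n ∸ t))) + D (suc n)
      ≡⟨ cong (_+ D (suc n)) (trans (Σ≤-+ n D _) (cong (ΣD n +_) (Σ≤-scale n q _))) ⟩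
    ΣD n + q * ΣDM n + D (suc n) ∎
    where
    open ≡-Reasoning
    D = maxDegreeClosed
    expand : ∀ d q m → d * (1 + q * m) ≡ d + q * (d * m)
    expand = solve-∀

  ΣDM-closed : ∀ n → ΣDM n ≡ M n * M n
  ΣDM-closed zero    = refl
  ΣDM-closed (suc n) = begin
    ΣDM (suc n)                              ≡⟨ ΣDM-suc n ⟩
    ΣD n + q * ΣDM n + D (suc n)             ≡⟨ cong (λ z → ΣD n + q * z + D (suc n)) (ΣDM-closed n) ⟩
    ΣD n + q * (M n * M n) + D (suc n)       ≡⟨ regroup (ΣD n) (q * (M n * M n)) (D (suc n)) ⟩
    ΣD (suc n) + q * (M n * M n)             ≡⟨ step ⟩
    (1 + q * M n) * (1 + q * M n)            ≡⟨ sym (cong₂ _*_ (M-suc n) (M-suc n)) ⟩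
    M (suc n) * M (suc n) ∎
    where
    open ≡-Reasoning
    D = maxDegreeClosed
    regroup : ∀ a b c → a + b + c ≡ (a + c) + b
    regroup = solve-∀
    hyp : p * ΣD (suc n) + 1 ≡ q * ((p * M n + 1) * (p * M n + 1))
    hyp = trans (ΣD-closed (suc n)) (trans (cong (λ z → q * (q * q ^ z)) (+-suc n n)) (cong (q *_) (M-geometric² n)))
    step : ΣD (suc n) + q * (M n * M n) ≡ (1 + q * M n) * (1 + q * M n)
    step = subst (λ z → ΣD (suc n) + z * (M n * M n) ≡ (1 + z * M n) * (1 + z * M n)) (sym q≡1+p)
      (ΣDM-step p (M n) (ΣD (suc n)) {{p-nonZero}}
        (subst (λ z → p * ΣD (suc n) + 1 ≡ z * ((p * M n + 1) * (p * M n + 1))) q≡1+p hyp))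

  ΣDM² : ℕ → ℕ
  ΣDM² n = Σ≤ n (λ t → maxDegreeClosed t * (M (n ∸ t) * M (n ∸ t)))

  ΣDM²-suc : ∀ n → ΣDM² (suc n) ≡ ΣD n + 2 * q * ΣDM n + q * q * ΣDM² n + maxDegreeClosed (suc n)
  ΣDM²-suc n = begin
    ΣDM² (suc n)
      ≡⟨ convolution-suc n D (λ k → M k * M k) ⟩
    Σ≤ n (λ t → D t * (M (suc (n ∸ t)) * M (suc (n ∸ t)))) + D (suc n) * (1 * 1)
      ≡⟨ cong₂ _+_ (Σ≤-ext n _ _ (λ t → trans (cong (λ z → D t * (z * z)) (M-suc (n ∸ t))) (expand (D t) q (M (n ∸ t)))))
                   (*-identityʳ (D (suc n))) ⟩
    Σ≤ n (λ t → (D t + 2 * q * (D t * M (n ∸ t))) + q * q * (D t * (M (n ∸ t) * M (n ∸ t)))) + D (suc n)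
      ≡⟨ cong (_+ D (suc n)) (trans (Σ≤-+ n _ _) (cong₂ _+_ (trans (Σ≤-+ n D _) (cong (ΣD n +_) (Σ≤-scale n (2 * q) _)))
                                                          (Σ≤-scale n (q * q) _))) ⟩
    ΣD n + 2 * q * ΣDM n + q * q * ΣDM² n + D (suc n) ∎
    where
    open ≡-Reasoning
    D = maxDegreeClosed
    expand : ∀ d q m → d * ((1 + q * m) * (1 + q * m)) ≡ (d + 2 * q * (d * m)) + q * q * (d * (m * m))
    expand = solve-∀

  ΣDM²-closed : ∀ n → p * p * ΣDM² n + M n * (2 + 3 * p * M n) ≡ (n + 1) * q ^ suc (n + n) * (q + 1)
  ΣDM²-closed zero = subst (λ z → p * p * (1 * (1 * 1)) + 1 * (2 + 3 * p * 1) ≡ 1 * (z * 1) * (z + 1)) (sym q≡1+p) (base p)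
    where
    base : ∀ p → p * p * (1 * (1 * 1)) + 1 * (2 + 3 * p * 1) ≡ 1 * (suc p * 1) * (suc p + 1)
    base = solve-∀
  ΣDM²-closed (suc n) = begin
    p * p * ΣDM² (suc n) + M (suc n) * (2 + 3 * p * M (suc n))
      ≡⟨ cong₂ (λ u v → p * p * u + v * (2 + 3 * p * v))
           (trans (ΣDM²-suc n) (cong (λ z → ΣD n + 2 * q * z + q * q * ΣDM² n + D (suc n)) (ΣDM-closed n))) (M-suc n) ⟩
    p * p * (ΣD n + 2 * q * (M n * M n) + q * q * ΣDM² n + Y * (q + 1)) + (1 + q * M n) * (2 + 3 * p * (1 + q * M n))
      ≡⟨ step ⟩
    (suc n + 1) * (q * q * Y) * (q + 1)
      ≡⟨ cong (λ z → (suc n + 1) * z * (q + 1)) (trans (*-assoc q q Y) (cong (λ z → q * q ^ z) (cong suc (sym (+-suc n n))))) ⟩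
    (suc n + 1) * q ^ suc (suc n + suc n) * (q + 1) ∎
    where
    open ≡-Reasoning
    D = maxDegreeClosed
    Y = q ^ suc (n + n)
    step : p * p * (ΣD n + 2 * q * (M n * M n) + q * q * ΣDM² n + Y * (q + 1)) + (1 + q * M n) * (2 + 3 * p * (1 + q * M n))
           ≡ (suc n + 1) * (q * q * Y) * (q + 1)
    step = subst (λ z → p * p * (ΣD n + 2 * z * (M n * M n) + z * z * ΣDM² n + Y * (z + 1)) + (1 + z * M n) * (2 + 3 * p * (1 + z * M n))
                        ≡ (suc n + 1) * (z * z * Y) * (z + 1)) (sym q≡1+p) (ΣDM²-step p n (M n) Y (ΣDM² n) (ΣD n)
      (subst (λ z → p * p * ΣDM² n + M n * (2 + 3 * p * M n) ≡ (n + 1) * Y * (z + 1)) q≡1+p (ΣDM²-closed n))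
      (ΣD-closed n)
      (subst (λ z → z * Y ≡ (p * M n + 1) * (p * M n + 1)) q≡1+p (M-geometric² n)))

module Enumeration (F : FiniteField) where
  open Field F
  open Degrees F
  open CoprimeDecision F
  open CoprimeCounts F
  open ClosedForms F
  open Poly F
  open ListSums

  monics : ℕ → List Monic
  monics zero    = map (0 ,_) (vectors 0)
  monics (suc n) = monics n ++ map (suc n ,_) (vectors (suc n))

  monics-degree : ∀ n {m} → m ∈ monics n → deg m ≤ n
  monics-degree zero    m∈ with ∈-map⁻ (0 ,_) m∈
  ... | _ , _ , refl = z≤n
  monics-degree (suc n) m∈ with ∈-++⁻ (monics n) m∈
  ... | inj₁ m∈′ = m≤n⇒m≤1+n (monics-degree n m∈′)
  ... | inj₂ m∈′ with ∈-map⁻ (suc n ,_) m∈′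
  ...   | _ , _ , refl = ≤-refl

  monics-complete : ∀ n (m : Monic) → deg m ≤ n → m ∈ monics n
  monics-complete zero    (zero , v) _ = ∈-map⁺ (0 ,_) (vectors-complete 0 v)
  monics-complete (suc n) (d , v) d≤1+n with d ≤? n
  ... | yes d≤n = ∈-++⁺ˡ (monics-complete n (d , v) d≤n)
  ... | no  d≰n with ≤-antisym d≤1+n (≰⇒> d≰n)
  ...   | refl = ∈-++⁺ʳ (monics n) (∈-map⁺ (suc n ,_) (vectors-complete (suc n) v))

  ,-injective-≡deg : ∀ {d} {v w : V d} → _≡_ {A = Monic} (d , v) (d , w) → v ≡ w
  ,-injective-≡deg refl = refl

  monics-unique : ∀ n → Unique (monics n)
  monics-unique zero    = map⁺ ,-injective-≡deg (vectors-unique 0)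
  monics-unique (suc n) = ++⁺ (monics-unique n) (map⁺ ,-injective-≡deg (vectors-unique (suc n))) disjoint
    where
    disjoint : ∀ {m} → ¬ (m ∈ monics n × m ∈ map (suc n ,_) (vectors (suc n)))
    disjoint (m∈ , m∈′) with ∈-map⁻ (suc n ,_) m∈′
    ... | _ , _ , refl = 1+n≰n (monics-degree n m∈)

  sumL-monics : ∀ n (f : Monic → ℕ) → sumL f (monics n) ≡ Σ≤ n (λ d → sumL (λ v → f (d , v)) (vectors d))
  sumL-monics zero    f = sumL-map f (0 ,_) (vectors 0)
  sumL-monics (suc n) f = trans (sumL-++ f (monics n) _) (cong₂ _+_ (sumL-monics n f) (sumL-map f (suc n ,_) (vectors (suc n))))

  admissible : ℕ → ℕ → ℕ
  admissible n t = count (λ a → does (deg a + t ≤? n)) (monics n)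

  admissible-closed : ∀ n t → t ≤ n → admissible n t ≡ M (n ∸ t)
  admissible-closed n t t≤n = begin
    admissible n t
      ≡⟨ sumL-monics n _ ⟩
    Σ≤ n (λ d → sumL (λ _ → bit (does (d + t ≤? n))) (vectors d))
      ≡⟨ Σ≤-ext n _ _ (λ d → trans (sumL-const _ (vectors d)) (trans (cong (_* bit (does (d + t ≤? n))) (vectors-length d)) (*-comm (q ^ d) _))) ⟩
    Σ≤ n (λ d → bit (does (d + t ≤? n)) * q ^ d)
      ≡⟨ cong (λ z → Σ≤ z (λ d → bit (does (d + t ≤? z)) * q ^ d)) (sym (m∸n+n≡m t≤n)) ⟩
    Σ≤ (k + t) (λ d → bit (does (d + t ≤? k + t)) * q ^ d)
      ≡⟨ Σ≤-ext (k + t) _ _ (λ d → cong (λ b → bit b * q ^ d) (does-⇔ (mk⇔ (+-cancelʳ-≤ t d k) (+-monoˡ-≤ t)) (d + t ≤? k + t) (d ≤? k))) ⟩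
    Σ≤ (k + t) (λ d → bit (does (d ≤? k)) * q ^ d)
      ≡⟨ Σ≤-truncate k t (q ^_) ⟩
    M k ∎
    where
    open ≡-Reasoning
    k = n ∸ t

  +⊔-≤⇔ : ∀ x y z n → (x + (y ⊔ z) ≤ n) ⇔ (x + y ≤ n × x + z ≤ n)
  +⊔-≤⇔ x y z n = mk⇔
    (λ le → ≤-trans (+-monoʳ-≤ x (m≤m⊔n y z)) le , ≤-trans (+-monoʳ-≤ x (m≤n⊔m y z)) le)
    (λ (l₁ , l₂) → subst (_≤ n) (sym (+-distribˡ-⊔ x y z)) (⊔-lub l₁ l₂))

  InS⇔ : ∀ n (a b c d : Monic) → deg a ≤ n → deg b ≤ n → deg c ≤ n → deg d ≤ n →
    InS n (a , b , c , d) ⇔ (Coprime (toPol b) (toPol c) × deg a + (deg b ⊔ deg c) ≤ n × deg d + (deg b ⊔ deg c) ≤ n)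
  InS⇔ n a b c d a≤n b≤n c≤n d≤n = mk⇔ to from
    where
    product : ∀ x y → InP n (toPol x *ₚ toPol y) ⇔ (deg x + deg y ≤ n)
    product = InP-*⇔ n
    product′ : ∀ x y → InP n (toPol y *ₚ toPol x) ⇔ (deg x + deg y ≤ n)
    product′ x y = ⇔.trans (product y x) (mk⇔ (subst (_≤ n) (+-comm (deg y) (deg x))) (subst (_≤ n) (+-comm (deg x) (deg y))))
    to : InS n (a , b , c , d) → _
    to (_ , _ , _ , _ , cop , ab , cd , ac , bd) = cop ,
      Equivalence.from (+⊔-≤⇔ (deg a) (deg b) (deg c) n) (Equivalence.to (product a b) ab , Equivalence.to (product a c) ac) ,
      Equivalence.from (+⊔-≤⇔ (deg d) (deg b) (deg c) n) (Equivalence.to (product′ d b) bd , Equivalence.to (product′ d c) cd)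
    from : _ → InS n (a , b , c , d)
    from (cop , a-bound , d-bound) with Equivalence.to (+⊔-≤⇔ (deg a) (deg b) (deg c) n) a-bound
                                      | Equivalence.to (+⊔-≤⇔ (deg d) (deg b) (deg c) n) d-bound
    ... | ab , ac | db , dc = a≤n , b≤n , c≤n , d≤n , cop ,
      Equivalence.from (product a b) ab , Equivalence.from (product′ d c) dc ,
      Equivalence.from (product a c) ac , Equivalence.from (product′ d b) db

  InP? : ∀ n a b → Dec (InP n (toPol a *ₚ toPol b))
  InP? n a b = Dec-map (⇔.sym (InP-*⇔ n a b)) (deg a + deg b ≤? n)

  coprimeₘ? : ∀ (b c : Monic) → Dec (Coprime (toPol b) (toPol c))
  coprimeₘ? (i , b) (j , c) = coprime? i b j c

  InS? : ∀ n (x : Quad) → Dec (InS n x)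
  InS? n (a , b , c , d) = (deg a ≤? n) ×-dec (deg b ≤? n) ×-dec (deg c ≤? n) ×-dec (deg d ≤? n) ×-dec
    coprimeₘ? b c ×-dec InP? n a b ×-dec InP? n c d ×-dec InP? n a c ×-dec InP? n b d

  -- quadruples are enumerated in the order (b, c, a, d), so that (a, d) is innermost
  reorder : Monic × Monic × Monic × Monic → Quad
  reorder (b , c , a , d) = (a , b , c , d)

  reorder-injective : ∀ {x y} → reorder x ≡ reorder y → x ≡ y
  reorder-injective {b , c , a , d} refl = refl

  ⟨bcad⟩ : ℕ → List (Monic × Monic × Monic × Monic)
  ⟨bcad⟩ n = cartesianProduct (monics n) (cartesianProduct (monics n) (cartesianProduct (monics n) (monics n)))

  𝒮 : ℕ → List Quad
  𝒮 n = filter (InS? n) (map reorder (⟨bcad⟩ n))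

  𝒮-unique : ∀ n → Unique (𝒮 n)
  𝒮-unique n = filter⁺ (InS? n) (map⁺ reorder-injective (cartesianProduct⁺ u (cartesianProduct⁺ u (cartesianProduct⁺ u u))))
    where u = monics-unique n

  𝒮-members : ∀ n x → (x ∈ 𝒮 n) ⇔ InS n x
  𝒮-members n x = mk⇔ (λ m → proj₂ (∈-filter⁻ (InS? n) {xs = map reorder (⟨bcad⟩ n)} m)) (into x)
    where
    into : ∀ x → InS n x → x ∈ 𝒮 n
    into (a , b , c , d) s@(a≤n , b≤n , c≤n , d≤n , _) = ∈-filter⁺ (InS? n)
      (∈-map⁺ reorder (∈-cartesianProduct⁺ (monics-complete n b b≤n) (∈-cartesianProduct⁺ (monics-complete n c c≤n)
        (∈-cartesianProduct⁺ (monics-complete n a a≤n) (monics-complete n d d≤n))))) s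

  simplifiedTest : ℕ → Monic × Monic × Monic × Monic → Bool
  simplifiedTest n (b , c , a , d) = does (coprimeₘ? b c) ∧ (fits a ∧ fits d)
    where
    fits : Monic → Bool
    fits x = does (deg x + (deg b ⊔ deg c) ≤? n)

  simplifiedTest-correct : ∀ n {y} → y ∈ ⟨bcad⟩ n → does (InS? n (reorder y)) ≡ simplifiedTest n y
  simplifiedTest-correct n {b , c , a , d} y∈ with ∈-cartesianProduct⁻ (monics n) _ y∈
  ... | b∈ , y∈′ with ∈-cartesianProduct⁻ (monics n) _ y∈′
  ... | c∈ , y∈″ with ∈-cartesianProduct⁻ (monics n) (monics n) y∈″
  ... | a∈ , d∈ = does-⇔
    (InS⇔ n a b c d (monics-degree n a∈) (monics-degree n b∈) (monics-degree n c∈) (monics-degree n d∈))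
    (InS? n (a , b , c , d))
    (coprimeₘ? b c ×-dec ((deg a + (deg b ⊔ deg c) ≤? n) ×-dec (deg d + (deg b ⊔ deg c) ≤? n)))

  weight : ℕ → ℕ → ℕ
  weight n t = admissible n t * admissible n t

  𝒮-size-pairs : ∀ n → length (𝒮 n) ≡
    sumL (λ b → sumL (λ c → bit (does (coprimeₘ? b c)) * weight n (deg b ⊔ deg c)) (monics n)) (monics n)
  𝒮-size-pairs n = begin
    length (𝒮 n)
      ≡⟨ length-filter (InS? n) (map reorder (⟨bcad⟩ n)) ⟩
    count (λ x → does (InS? n x)) (map reorder (⟨bcad⟩ n))
      ≡⟨ sumL-map _ reorder (⟨bcad⟩ n) ⟩
    count (λ y → does (InS? n (reorder y))) (⟨bcad⟩ n)
      ≡⟨ sumL-ext∈ _ _ (⟨bcad⟩ n) (cong bit ∘ simplifiedTest-correct n) ⟩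
    count (simplifiedTest n) (⟨bcad⟩ n)
      ≡⟨ sumL-cp _ Mn _ ⟩
    sumL (λ b → count (λ y → simplifiedTest n (b , y)) (cartesianProduct Mn (cartesianProduct Mn Mn))) Mn
      ≡⟨ sumL-ext _ _ Mn (λ b → trans (sumL-cp _ Mn (cartesianProduct Mn Mn)) (sumL-ext _ _ Mn (λ c → inner b c))) ⟩
    sumL (λ b → sumL (λ c → bit (does (coprimeₘ? b c)) * weight n (deg b ⊔ deg c)) Mn) Mn ∎
    where
    open ≡-Reasoning
    Mn = monics n
    inner : ∀ b c → count (λ ad → simplifiedTest n (b , c , ad)) (cartesianProduct Mn Mn)
                  ≡ bit (does (coprimeₘ? b c)) * weight n (deg b ⊔ deg c)
    inner b c = trans (count-∧ˡ (does (coprimeₘ? b c)) _ (cartesianProduct Mn Mn))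
      (cong (bit (does (coprimeₘ? b c)) *_) (count-cp _ _ Mn Mn))

  𝒮-size-degrees : ∀ n → length (𝒮 n) ≡ Σ≤ n (λ i → Σ≤ n (λ j → weight n (i ⊔ j) * coprimeCount i j))
  𝒮-size-degrees n = begin
    length (𝒮 n)
      ≡⟨ 𝒮-size-pairs n ⟩
    sumL (λ b → sumL (h b) (monics n)) (monics n)
      ≡⟨ sumL-ext _ _ (monics n) (λ b → sumL-monics n (h b)) ⟩
    sumL (λ b → Σ≤ n (λ j → sumL (λ w → h b (j , w)) (vectors j))) (monics n)
      ≡⟨ sumL-monics n _ ⟩
    Σ≤ n (λ i → sumL (λ v → Σ≤ n (λ j → sumL (λ w → h (i , v) (j , w)) (vectors j))) (vectors i))
      ≡⟨ Σ≤-ext n _ _ (λ i → sumL-Σ≤ n (λ v j → sumL (λ w → h (i , v) (j , w)) (vectors j)) (vectors i)) ⟩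
    Σ≤ n (λ i → Σ≤ n (λ j → sumL (λ v → sumL (λ w → h (i , v) (j , w)) (vectors j)) (vectors i)))
      ≡⟨ Σ≤-ext n _ _ (λ i → Σ≤-ext n _ _ (λ j → by-degrees i j)) ⟩
    Σ≤ n (λ i → Σ≤ n (λ j → weight n (i ⊔ j) * coprimeCount i j)) ∎
    where
    open ≡-Reasoning
    h : Monic → Monic → ℕ
    h b c = bit (does (coprimeₘ? b c)) * weight n (deg b ⊔ deg c)
    by-degrees : ∀ i j → sumL (λ v → sumL (λ w → h (i , v) (j , w)) (vectors j)) (vectors i) ≡ weight n (i ⊔ j) * coprimeCount i j
    by-degrees i j = begin
      sumL (λ v → sumL (λ w → bit (coprimeTest i j (v , w)) * K) (vectors j)) (vectors i)
        ≡⟨ sumL-ext _ _ (vectors i) (λ v → trans (sumL-ext _ _ (vectors j) (λ w → *-comm _ K)) (sumL-scale K _ (vectors j))) ⟩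
      sumL (λ v → K * sumL (λ w → bit (coprimeTest i j (v , w))) (vectors j)) (vectors i)
        ≡⟨ sumL-scale K _ (vectors i) ⟩
      K * sumL (λ v → sumL (λ w → bit (coprimeTest i j (v , w))) (vectors j)) (vectors i)
        ≡⟨ cong (K *_) (sym (sumL-cp _ (vectors i) (vectors j))) ⟩
      K * coprimeCount i j ∎
      where K = weight n (i ⊔ j)

  𝒮-size : ∀ n → length (𝒮 n) ≡ ΣDM² n
  𝒮-size n = begin
    length (𝒮 n)
      ≡⟨ 𝒮-size-degrees n ⟩
    Σ≤ n (λ i → Σ≤ n (H i))
      ≡⟨ Σ≤-square n H ⟩
    Σ≤ n (λ t → Σ≤ t (H t) + Σ< t (λ i → H i t))
      ≡⟨ Σ≤-ext n _ _ (λ t → trans (cong₂ _+_ (row t) (column t)) (sym (*-distribˡ-+ (weight n t) _ _))) ⟩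
    Σ≤ n (λ t → weight n t * maxDegreeCount t)
      ≡⟨ Σ≤-ext≤ n _ _ (λ t t≤n → trans (cong₂ (λ u v → u * u * v) (admissible-closed n t t≤n) (maxDegreeCount-closed t))
                                        (*-comm _ (maxDegreeClosed t))) ⟩
    ΣDM² n ∎
    where
    open ≡-Reasoning
    H : ℕ → ℕ → ℕ
    H i j = weight n (i ⊔ j) * coprimeCount i j
    row : ∀ t → Σ≤ t (H t) ≡ weight n t * Σ≤ t (coprimeCount t)
    row t = trans (Σ≤-ext≤ t _ _ (λ j j≤t → cong (λ z → weight n z * coprimeCount t j) (m≥n⇒m⊔n≡m j≤t)))
                  (Σ≤-scale t (weight n t) (coprimeCount t))
    column : ∀ t → Σ< t (λ i → H i t) ≡ weight n t * Σ< t (λ i → coprimeCount i t)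
    column zero    = sym (*-zeroʳ (weight n 0))
    column (suc t) = trans (Σ≤-ext≤ t _ _ (λ i i≤t → cong (λ z → weight n z * coprimeCount i (suc t)) (m≤n⇒m⊔n≡n (m≤n⇒m≤1+n i≤t))))
                           (Σ≤-scale t (weight n (suc t)) (λ i → coprimeCount i (suc t)))

-- |𝒮ₙ*|·(q−1)³ + (q^(n+1) − 1)(3q^(n+1) − 1) = (n+1)q^(2n+1)(q+1)(q−1)
lemma16 : (F : FiniteField) → (n : ℕ) → 1 ≤ n →
    let open FiniteField F using (q) in
    let open Poly F in
    ∃ λ (L : List Quad) →
    Unique L × (∀ x → (x ∈ L) ⇔ InS n x) ×
    ((q ∸ 1) ^ 3 * length L + (q ^ (n + 1) ∸ 1) * (3 * q ^ (n + 1) ∸ 1)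
    ≡ (n + 1) * q ^ (2 * n + 1) * (q + 1) * (q ∸ 1))
lemma16 F n _ = 𝒮 n , 𝒮-unique n , 𝒮-members n , (begin
    p ^ 3 * length (𝒮 n) + (q ^ (n + 1) ∸ 1) * (3 * q ^ (n + 1) ∸ 1)
      ≡⟨ cong₂ (λ s X → p ^ 3 * s + (X ∸ 1) * (3 * X ∸ 1)) (𝒮-size n) q^[n+1]≡1+p·M ⟩
    p ^ 3 * ΣDM² n + (suc (p * M n) ∸ 1) * (3 * suc (p * M n) ∸ 1)
      ≡⟨ cong (p ^ 3 * ΣDM² n +_) (pred-times-pred-triple (p * M n)) ⟩
    p ^ 3 * ΣDM² n + p * M n * (2 + 3 * (p * M n))
      ≡⟨ times-p p (M n) (ΣDM² n) _ (ΣDM²-closed n) ⟩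
    (n + 1) * q ^ suc (n + n) * (q + 1) * p
      ≡⟨ cong (λ e → (n + 1) * q ^ e * (q + 1) * p) (sym (2n+1≡1+n+n n)) ⟩
    (n + 1) * q ^ (2 * n + 1) * (q + 1) * p ∎)
  where
  open ≡-Reasoning
  open Field F using (q; p)
  open ClosedForms F using (M; M-geometric; ΣDM²; ΣDM²-closed)
  open Enumeration F using (𝒮; 𝒮-unique; 𝒮-members; 𝒮-size)
  open StepIdentities using (pred-times-pred-triple; times-p; 2n+1≡1+n+n)
  q^[n+1]≡1+p·M : q ^ (n + 1) ≡ suc (p * M n)
  q^[n+1]≡1+p·M = trans (cong (q ^_) (+-comm n 1)) (trans (sym (M-geometric n)) (+-comm (p * M n) 1))
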